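{- Let $p$ be a prime and let $F(X)\in\mathbb{F}_p[X]$ be a square-free polynomial of degree $d_F\geq1$. Let $b_1,\dots,b_L$ be distinct elements of $\mathbb{F}_p$ with $L<(\log p)/\log(4d_F)$. Then for any nonzero $a\in\mathbb{F}_p$, the polynomial $H(X)=\prod_{j=1}^LF(aX+b_j)$ is not a square in $\mathbb{F}_p(X)$. -}

module Defs where

open import Data.Nat as ℕ using (ℕ; zero; suc; _<_)
open import Data.Integer using (ℤ; +_; _-_; _*_; _+_)
open import Data.Integer.Divisibility using (_∣_)
open import Data.List using (List; []; _∷_; map)
open import Data.Fin using (Fin; zero; suc)
open import Data.Product using (Σ; _×_; ∃)
open import Relation.Nullary using (¬_)

-- Polynomials with integer coefficients (constant term first), read in F_p[X]
-- by reducing coefficients modulo p.  All notions below are taken modulo p.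
Poly : Set
Poly = List ℤ

coeff : Poly → ℕ → ℤ
coeff []       _       = + 0
coeff (c ∷ _)  zero    = c
coeff (_ ∷ cs) (suc i) = coeff cs i

infixl 6 _+ₚ_
infixl 7 _*ₚ_

_+ₚ_ : Poly → Poly → Poly
[]       +ₚ q        = q
(a ∷ as) +ₚ []       = a ∷ as
(a ∷ as) +ₚ (b ∷ bs) = (a + b) ∷ (as +ₚ bs)

_*ₚ_ : Poly → Poly → Poly
[]       *ₚ q = []
(a ∷ as) *ₚ q = map (a *_) q +ₚ (+ 0 ∷ (as *ₚ q))

oneₚ : Poly
oneₚ = + 1 ∷ []

lin : ℤ → ℤ → Poly
lin a b = b ∷ a ∷ []

-- composition F(G), by Horner: F = c₀ + X·F' gives F(G) = c₀ + G·F'(G)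
compose : Poly → Poly → Poly
compose []       G = []
compose (c ∷ cs) G = (c ∷ []) +ₚ (G *ₚ compose cs G)

prodFin : (n : ℕ) → (Fin n → Poly) → Poly
prodFin zero    f = oneₚ
prodFin (suc n) f = f zero *ₚ prodFin n (λ j → f (suc j))

infix 4 _≡[_]_ _≈[_]_

_≡[_]_ : ℤ → ℕ → ℤ → Set
x ≡[ p ] y = (+ p) ∣ (x - y)

_≈[_]_ : Poly → ℕ → Poly → Set
P ≈[ p ] Q = ∀ i → coeff P i ≡[ p ] coeff Q i

NonZeroPoly : ℕ → Poly → Set
NonZeroPoly p P = ∃ λ i → ¬ (coeff P i ≡[ p ] + 0)

HasDegree : ℕ → Poly → ℕ → Set
HasDegree p P d = ¬ (coeff P d ≡[ p ] + 0) × (∀ i → d < i → coeff P i ≡[ p ] + 0)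

DividesPoly : ℕ → Poly → Poly → Set
DividesPoly p G F = ∃ λ Q → (G *ₚ Q) ≈[ p ] F

SquareFree : ℕ → Poly → Set
SquareFree p F = ∀ G d → HasDegree p G d → 1 ℕ.≤ d → ¬ DividesPoly p (G *ₚ G) F

-- H is a square in the rational function field F_p(X):
-- H = (A/B)² for some A, B ∈ F_p[X] with B ≠ 0, i.e. H·B² = A²
IsSquareInFracField : ℕ → Poly → Set
IsSquareInFracField p H =
  ∃ λ A → ∃ λ B → NonZeroPoly p B × (H *ₚ (B *ₚ B)) ≈[ p ] (A *ₚ A)

-- Let P be an irreducible factor of F.  As deg P < p, distinct shifts P(X + s), 0 ≤ s < p, do not
-- divide one another, so at most deg F of them divide F.  Since (4 deg F)^L < p, a pigeonhole argument
-- of Dirichlet type finds among these shifts an s* and an index j* such that s + b_j = s* + b_j* forces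
-- j = j*.  Then Q = P(aX + s* + b_j*) divides exactly one factor F(aX + b_j) of H, and only once since
-- F is square-free.  So H = Q·R with Q prime and Q ∤ R, and H·B² = A² is impossible by descent on deg B.

module Submission where

open import Defs
open import Algebra.Bundles using (CommutativeRing)
import Algebra.Solver.Ring
open import Algebra.Solver.Ring.AlmostCommutativeRing using (fromCommutativeRing; _-Raw-AlmostCommutative⟶_)
open import Data.Empty using (⊥; ⊥-elim)
open import Data.Fin as Fin using (Fin; toℕ; fromℕ<; funToFin; finToFun) renaming (zero to fzero; suc to fsuc)
import Data.Fin.Properties as FinP
open import Data.Integer as ℤ using (ℤ; +_; -_; ∣_∣)
import Data.Integer.Divisibility.Signed as ℤS
open import Data.Integer.DivMod using (_%ℕ_; _/ℕ_; n%ℕd<d; a≡a%ℕn+[a/ℕn]*n)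
import Data.Integer.Properties as ℤP
open import Data.Integer.Tactic.RingSolver using (solve-∀)
open import Data.List using ([]; _∷_; map)
open import Data.Maybe using (Maybe; just; nothing)
open import Data.Nat as ℕ using (ℕ; zero; suc; z≤n; s≤s; _≤_; _<_; _∸_; _^_; NonZero)
open import Data.Nat.Coprimality using (Coprime; coprime-Bézout)
import Data.Nat.Divisibility as ℕD
open import Data.Nat.DivMod using (_%_; _/_; m≡m%n+[m/n]*n; m%n<n; m/n*n≤m; m<n*o⇒m/o<n)
open import Data.Nat.GCD using (module Bézout)
open import Data.Nat.Induction using (<-rec)
open import Data.Nat.Primality using (Prime; euclidsLemma; prime⇒irreducible; prime⇒nonZero; prime⇒nonTrivial)
import Data.Nat.Properties as ℕP
open import Data.Nat.Tactic.RingSolver using () renaming (solve-∀ to ℕ-solve-∀)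
open import Data.Product using (∃; ∃₂; _×_; _,_; proj₁; proj₂)
import Data.Sum as Sum
open Sum using (_⊎_; inj₁; inj₂; [_,_]′)
open import Relation.Binary.Bundles using (Setoid)
open import Relation.Binary.Definitions using (tri<; tri≈; tri>)
open import Relation.Binary.PropositionalEquality
import Relation.Binary.Reasoning.Setoid
open import Relation.Nullary using (¬_; Dec; yes; no; contradiction)
open import Relation.Nullary.Decidable using (decidable-stable)

module Convolution where

  open import Data.Integer using (_+_; _*_)

  conv : (ℕ → ℤ) → (ℕ → ℤ) → ℕ → ℤ
  conv f g zero    = f 0 * g 0
  conv f g (suc i) = f 0 * g (suc i) + conv (λ k → f (suc k)) g i

  coeff-+ₚ : ∀ P Q i → coeff (P +ₚ Q) i ≡ coeff P i + coeff Q i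
  coeff-+ₚ []      Q       i       = sym (ℤP.+-identityˡ (coeff Q i))
  coeff-+ₚ (a ∷ P) []      i       = sym (ℤP.+-identityʳ (coeff (a ∷ P) i))
  coeff-+ₚ (a ∷ P) (b ∷ Q) zero    = refl
  coeff-+ₚ (a ∷ P) (b ∷ Q) (suc i) = coeff-+ₚ P Q i

  coeff-map : ∀ a Q i → coeff (map (a *_) Q) i ≡ a * coeff Q i
  coeff-map a []      i       = sym (ℤP.*-zeroʳ a)
  coeff-map a (x ∷ Q) zero    = refl
  coeff-map a (x ∷ Q) (suc i) = coeff-map a Q i

  conv-zeroˡ : ∀ g i → conv (λ _ → + 0) g i ≡ + 0
  conv-zeroˡ g zero    = refl
  conv-zeroˡ g (suc i) = cong₂ _+_ (ℤP.*-zeroˡ (g (suc i))) (conv-zeroˡ g i)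

  coeff-*ₚ : ∀ P Q i → coeff (P *ₚ Q) i ≡ conv (coeff P) (coeff Q) i
  coeff-*ₚ []      Q i       = sym (conv-zeroˡ (coeff Q) i)
  coeff-*ₚ (a ∷ P) Q zero    =
    trans (coeff-+ₚ (map (a *_) Q) _ 0) (trans (cong (_+ + 0) (coeff-map a Q 0)) (ℤP.+-identityʳ _))
  coeff-*ₚ (a ∷ P) Q (suc i) =
    trans (coeff-+ₚ (map (a *_) Q) _ (suc i)) (cong₂ _+_ (coeff-map a Q (suc i)) (coeff-*ₚ P Q i))

  conv-cong : ∀ {f f' g g' : ℕ → ℤ} → (∀ k → f k ≡ f' k) → (∀ k → g k ≡ g' k) →
              ∀ i → conv f g i ≡ conv f' g' i
  conv-cong ef eg zero    = cong₂ _*_ (ef 0) (eg 0)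
  conv-cong ef eg (suc i) = cong₂ _+_ (cong₂ _*_ (ef 0) (eg (suc i))) (conv-cong (λ k → ef (suc k)) eg i)

  conv-sucʳ : ∀ f g i → conv f g (suc i) ≡ conv f (λ k → g (suc k)) i + f (suc i) * g 0
  conv-sucʳ f g zero    = refl
  conv-sucʳ f g (suc i) =
    trans (cong (_+_ (f 0 * g (suc (suc i)))) (conv-sucʳ (λ k → f (suc k)) g i))
          (sym (ℤP.+-assoc (f 0 * g (suc (suc i))) _ _))

  conv-comm : ∀ f g i → conv f g i ≡ conv g f i
  conv-comm f g zero    = ℤP.*-comm (f 0) (g 0)
  conv-comm f g (suc i) = begin
    f 0 * g (suc i) + conv (λ k → f (suc k)) g i  ≡⟨ cong (_+_ (f 0 * g (suc i))) (conv-comm (λ k → f (suc k)) g i) ⟩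
    f 0 * g (suc i) + conv g (λ k → f (suc k)) i  ≡⟨ swap (f 0) (g (suc i)) _ ⟩
    conv g (λ k → f (suc k)) i + g (suc i) * f 0  ≡⟨ sym (conv-sucʳ g f i) ⟩
    conv g f (suc i)                              ∎
    where
    open ≡-Reasoning
    swap : ∀ a b c → a * b + c ≡ c + b * a
    swap = solve-∀

  conv-+ˡ : ∀ f f' g i → conv (λ k → f k + f' k) g i ≡ conv f g i + conv f' g i
  conv-+ˡ f f' g zero    = ℤP.*-distribʳ-+ (g 0) (f 0) (f' 0)
  conv-+ˡ f f' g (suc i) =
    trans (cong (_+_ ((f 0 + f' 0) * g (suc i))) (conv-+ˡ (λ k → f (suc k)) (λ k → f' (suc k)) g i))
          (regroup (f 0) (f' 0) (g (suc i)) _ _)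
    where
    regroup : ∀ a b c x y → (a + b) * c + (x + y) ≡ (a * c + x) + (b * c + y)
    regroup = solve-∀

  conv-*ˡ : ∀ c f g i → conv (λ k → c * f k) g i ≡ c * conv f g i
  conv-*ˡ c f g zero    = ℤP.*-assoc c (f 0) (g 0)
  conv-*ˡ c f g (suc i) =
    trans (cong (_+_ (c * f 0 * g (suc i))) (conv-*ˡ c (λ k → f (suc k)) g i))
          (factor c (f 0) (g (suc i)) _)
    where
    factor : ∀ c a b x → c * a * b + c * x ≡ c * (a * b + x)
    factor = solve-∀

  conv-assoc : ∀ f g h i → conv (conv f g) h i ≡ conv f (conv g h) i
  conv-assoc f g h zero    = ℤP.*-assoc (f 0) (g 0) (h 0)
  conv-assoc f g h (suc i) = begin
    conv f g 0 * h (suc i) + conv (λ k → conv f g (suc k)) h i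
      ≡⟨ cong (_+_ (conv f g 0 * h (suc i))) (conv-+ˡ (λ k → f 0 * g (suc k)) (conv f⁺ g) h i) ⟩
    conv f g 0 * h (suc i) + (conv (λ k → f 0 * g (suc k)) h i + conv (conv f⁺ g) h i)
      ≡⟨ cong₂ (λ a b → conv f g 0 * h (suc i) + (a + b)) (conv-*ˡ (f 0) (λ k → g (suc k)) h i) (conv-assoc f⁺ g h i) ⟩
    f 0 * g 0 * h (suc i) + (f 0 * conv (λ k → g (suc k)) h i + conv f⁺ (conv g h) i)
      ≡⟨ factor (f 0) (g 0) (h (suc i)) _ _ ⟩
    f 0 * (g 0 * h (suc i) + conv (λ k → g (suc k)) h i) + conv f⁺ (conv g h) i
      ∎
    where
    open ≡-Reasoning
    f⁺ : ℕ → ℤ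
    f⁺ k = f (suc k)
    factor : ∀ a b c x y → a * b * c + (a * x + y) ≡ a * (b * c + x) + y
    factor = solve-∀

  conv-oneˡ : ∀ g i → conv (coeff oneₚ) g i ≡ g i
  conv-oneˡ g zero    = ℤP.*-identityˡ (g 0)
  conv-oneˡ g (suc i) =
    trans (cong (_+_ (+ 1 * g (suc i))) (conv-zeroˡ g i))
          (trans (ℤP.+-identityʳ _) (ℤP.*-identityˡ (g (suc i))))

open Convolution

record Enumeration (D : ℕ → Set) (n : ℕ) : Set where
  field
    size      : ℕ
    elem      : Fin size → ℕ
    elem<n    : ∀ i → elem i < n
    elem∈D    : ∀ i → D (elem i)
    complete  : ∀ {s} → s < n → D s → ∃ λ i → elem i ≡ s
    injective : ∀ {i i'} → elem i ≡ elem i' → i ≡ i'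

enumerate : ∀ {D : ℕ → Set} → (∀ s → Dec (D s)) → ∀ n → Enumeration D n
enumerate D? zero = record
  { size = 0 ; elem = λ () ; elem<n = λ () ; elem∈D = λ () ; complete = λ () ; injective = λ { {()} } }
enumerate {D} D? (suc n) = extend (D? n)
  where
  open Enumeration (enumerate D? n)
  below : ∀ {s} → s < suc n → s < n ⊎ s ≡ n
  below (s≤s s≤n) = ℕP.m≤n⇒m<n∨m≡n s≤n
  extend : Dec (D n) → Enumeration D (suc n)
  extend (no ¬Dn) = record
    { size = size ; elem = elem ; elem<n = λ i → ℕP.m<n⇒m<1+n (elem<n i) ; elem∈D = elem∈D
    ; complete = complete' ; injective = injective }
    where
    complete' : ∀ {s} → s < suc n → D s → ∃ λ i → elem i ≡ s
    complete' s<1+n Ds with below s<1+n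
    ... | inj₁ s<n  = complete s<n Ds
    ... | inj₂ refl = ⊥-elim (¬Dn Ds)
  extend (yes Dn) = record
    { size = suc size ; elem = elem' ; elem<n = elem'<n ; elem∈D = elem'∈D
    ; complete = complete' ; injective = injective' }
    where
    elem' : Fin (suc size) → ℕ
    elem' fzero    = n
    elem' (fsuc i) = elem i
    elem'<n : ∀ i → elem' i < suc n
    elem'<n fzero    = ℕP.n<1+n n
    elem'<n (fsuc i) = ℕP.m<n⇒m<1+n (elem<n i)
    elem'∈D : ∀ i → D (elem' i)
    elem'∈D fzero    = Dn
    elem'∈D (fsuc i) = elem∈D i
    complete' : ∀ {s} → s < suc n → D s → ∃ λ i → elem' i ≡ s
    complete' s<1+n Ds with below s<1+n
    ... | inj₁ s<n  = let (i , eq) = complete s<n Ds in fsuc i , eq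
    ... | inj₂ refl = fzero , refl
    injective' : ∀ {i i'} → elem' i ≡ elem' i' → i ≡ i'
    injective' {fzero}  {fzero}   _  = refl
    injective' {fzero}  {fsuc i'} eq = ⊥-elim (ℕP.<-irrefl (sym eq) (elem<n i'))
    injective' {fsuc i} {fzero}   eq = ⊥-elim (ℕP.<-irrefl eq (elem<n i))
    injective' {fsuc i} {fsuc i'} eq = cong fsuc (injective eq)

module Modulo (p : ℕ) (p-prime : Prime p) where

  open import Data.Integer using (_+_; _-_; _*_)

  instance
    p≢0 : NonZero p
    p≢0 = prime⇒nonZero p-prime

  1<p : 1 ℕ.< p
  1<p = ℕ.nonTrivial⇒n>1 p {{prime⇒nonTrivial p-prime}}

  -- A record rather than x ≡[ p ] y itself, so that x and y can be inferred.
  infix 4 _≈_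
  record _≈_ (x y : ℤ) : Set where
    constructor mk≈
    field ≈⇒≡[p] : x ≡[ p ] y
  open _≈_ public

  ≈-by : ∀ {x y} d → d ≡ x - y → + p ℤS.∣ d → x ≈ y
  ≈-by _ refl p∣d = mk≈ (ℤS.∣⇒∣ᵤ p∣d)

  ≈⇒∣ : ∀ {x y} → x ≈ y → + p ℤS.∣ x - y
  ≈⇒∣ x≈y = ℤS.∣ᵤ⇒∣ (≈⇒≡[p] x≈y)

  ≈-multiple : ∀ {x y} q → x ≡ y + q * + p → x ≈ y
  ≈-multiple {x} {y} q refl = ≈-by (q * + p) (sym (cancel y (q * + p))) (ℤS.divides q refl)
    where
    cancel : ∀ a b → (a + b) - a ≡ b
    cancel = solve-∀

  ≈-refl : ∀ {x} → x ≈ x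
  ≈-refl {x} = ≈-multiple (+ 0) (sym (ℤP.+-identityʳ x))

  ≈-reflexive : ∀ {x y} → x ≡ y → x ≈ y
  ≈-reflexive refl = ≈-refl

  ≈-sym : ∀ {x y} → x ≈ y → y ≈ x
  ≈-sym {x} {y} x≈y = ≈-by _ (negate x y) (ℤS.∣m⇒∣-m (≈⇒∣ x≈y))
    where
    negate : ∀ x y → - (x - y) ≡ y - x
    negate = solve-∀

  ≈-trans : ∀ {x y z} → x ≈ y → y ≈ z → x ≈ z
  ≈-trans {x} {y} {z} x≈y y≈z = ≈-by _ (telescope x y z) (ℤS.∣m∣n⇒∣m+n (≈⇒∣ x≈y) (≈⇒∣ y≈z))
    where
    telescope : ∀ x y z → (x - y) + (y - z) ≡ x - z
    telescope = solve-∀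

  ≈-setoid : Setoid _ _
  ≈-setoid = record
    { Carrier = ℤ ; _≈_ = _≈_
    ; isEquivalence = record { refl = ≈-refl ; sym = ≈-sym ; trans = ≈-trans } }

  module ≈-Reasoning = Relation.Binary.Reasoning.Setoid ≈-setoid

  +-cong : ∀ {x x' y y'} → x ≈ x' → y ≈ y' → x + y ≈ x' + y'
  +-cong {x} {x'} {y} {y'} x≈x' y≈y' = ≈-by _ (regroup x x' y y') (ℤS.∣m∣n⇒∣m+n (≈⇒∣ x≈x') (≈⇒∣ y≈y'))
    where
    regroup : ∀ x x' y y' → (x - x') + (y - y') ≡ (x + y) - (x' + y')
    regroup = solve-∀

  *-cong : ∀ {x x' y y'} → x ≈ x' → y ≈ y' → x * y ≈ x' * y'
  *-cong {x} {x'} {y} {y'} x≈x' y≈y' =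
    ≈-by _ (regroup x x' y y') (ℤS.∣m∣n⇒∣m+n (ℤS.∣m⇒∣m*n y (≈⇒∣ x≈x')) (ℤS.∣n⇒∣m*n x' (≈⇒∣ y≈y')))
    where
    regroup : ∀ x x' y y' → (x - x') * y + x' * (y - y') ≡ x * y - x' * y'
    regroup = solve-∀

  -‿cong : ∀ {x y} → x ≈ y → - x ≈ - y
  -‿cong {x} {y} x≈y = ≈-by _ (negate x y) (ℤS.∣m⇒∣-m (≈⇒∣ x≈y))
    where
    negate : ∀ x y → - (x - y) ≡ - x - - y
    negate = solve-∀

  p≈0 : + p ≈ + 0
  p≈0 = ≈-multiple (+ 1) (sym (trans (ℤP.+-identityˡ _) (ℤP.*-identityˡ (+ p))))

  +-cancelˡ : ∀ x {y z} → x + y ≈ x + z → y ≈ z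
  +-cancelˡ x {y} {z} x+y≈x+z = begin
    y              ≡⟨ add-sub x y ⟩
    - x + (x + y)  ≈⟨ +-cong (≈-refl { - x}) x+y≈x+z ⟩
    - x + (x + z)  ≡⟨ add-sub x z ⟨
    z              ∎
    where
    open ≈-Reasoning
    add-sub : ∀ x y → y ≡ - x + (x + y)
    add-sub = solve-∀

  +-cancelʳ : ∀ {x y} z → x + z ≈ y + z → x ≈ y
  +-cancelʳ {x} {y} z x+z≈y+z =
    +-cancelˡ z (≈-trans (≈-reflexive (ℤP.+-comm z x)) (≈-trans x+z≈y+z (≈-reflexive (ℤP.+-comm y z))))

  ≈0⇒∣ : ∀ {x} → x ≈ + 0 → p ℕD.∣ ∣ x ∣
  ≈0⇒∣ {x} x≈0 = subst (λ z → p ℕD.∣ ∣ z ∣) (ℤP.+-identityʳ x) (≈⇒≡[p] x≈0)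

  ∣⇒≈0 : ∀ {x} → p ℕD.∣ ∣ x ∣ → x ≈ + 0
  ∣⇒≈0 {x} p∣x = mk≈ (subst (λ z → p ℕD.∣ ∣ z ∣) (sym (ℤP.+-identityʳ x)) p∣x)

  ≈0? : ∀ x → Dec (x ≈ + 0)
  ≈0? x with p ℕD.∣? ∣ x ∣
  ... | yes p∣x = yes (∣⇒≈0 p∣x)
  ... | no p∤x  = no (λ x≈0 → p∤x (≈0⇒∣ x≈0))

  <p∧≈0⇒≡0 : ∀ {n} → n ℕ.< p → + n ≈ + 0 → n ≡ 0
  <p∧≈0⇒≡0 {zero}  _   _   = refl
  <p∧≈0⇒≡0 {suc n} n<p n≈0 = contradiction (≈0⇒∣ n≈0) (ℕD.>⇒∤ n<p)

  ≤-≈⇒≡ : ∀ {m n} → m ℕ.≤ n → n ℕ.< p → + m ≈ + n → m ≡ n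
  ≤-≈⇒≡ {m} {n} m≤n n<p m≈n = ℕP.≤-antisym m≤n (ℕP.m∸n≡0⇒m≤n (<p∧≈0⇒≡0 n∸m<p n-m≈0))
    where
    n∸m<p : n ℕ.∸ m ℕ.< p
    n∸m<p = ℕP.≤-<-trans (ℕP.m∸n≤m n m) n<p
    n-m≈0 : + (n ℕ.∸ m) ≈ + 0
    n-m≈0 = ∣⇒≈0 (subst (p ℕD.∣_) (trans (cong ∣_∣ (ℤP.m-n≡m⊖n n m)) (trans (ℤP.∣m⊖n∣≡∣n⊖m∣ n m) (ℤP.∣⊖∣-≤ m≤n)))
                   (≈0⇒∣ (≈-trans (+-cong (≈-sym m≈n) (≈-refl { - + m})) (≈-reflexive (ℤP.+-inverseʳ (+ m))))))

  <p-≈⇒≡ : ∀ {m n} → m ℕ.< p → n ℕ.< p → + m ≈ + n → m ≡ n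
  <p-≈⇒≡ {m} {n} m<p n<p m≈n with ℕP.≤-total m n
  ... | inj₁ m≤n = ≤-≈⇒≡ m≤n n<p m≈n
  ... | inj₂ n≤m = sym (≤-≈⇒≡ n≤m m<p (≈-sym m≈n))

  1≤n<p⇒≉0 : ∀ {n} → 1 ℕ.≤ n → n ℕ.< p → ¬ (+ n ≈ + 0)
  1≤n<p⇒≉0 1≤n n<p n≈0 = ℕP.<⇒≢ 1≤n (sym (<p∧≈0⇒≡0 n<p n≈0))

  reduce : ℤ → ℕ
  reduce x = x %ℕ p

  reduce<p : ∀ x → reduce x ℕ.< p
  reduce<p x = n%ℕd<d x p

  reduce≈ : ∀ x → + reduce x ≈ x
  reduce≈ x = ≈-sym (≈-multiple (x /ℕ p) (a≡a%ℕn+[a/ℕn]*n x p))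

  *≈0⇒ : ∀ x y → x * y ≈ + 0 → x ≈ + 0 ⊎ y ≈ + 0
  *≈0⇒ x y xy≈0 with euclidsLemma ∣ x ∣ ∣ y ∣ p-prime (subst (p ℕD.∣_) (ℤP.abs-* x y) (≈0⇒∣ xy≈0))
  ... | inj₁ p∣x = inj₁ (∣⇒≈0 p∣x)
  ... | inj₂ p∣y = inj₂ (∣⇒≈0 p∣y)

  *-≉0 : ∀ {x y} → ¬ x ≈ + 0 → ¬ y ≈ + 0 → ¬ x * y ≈ + 0
  *-≉0 {x} {y} x≉0 y≉0 xy≈0 with *≈0⇒ x y xy≈0
  ... | inj₁ x≈0 = x≉0 x≈0
  ... | inj₂ y≈0 = y≉0 y≈0

  *-cancelˡ : ∀ {t x y} → ¬ t ≈ + 0 → t * x ≈ t * y → x ≈ y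
  *-cancelˡ {t} {x} {y} t≉0 tx≈ty with *≈0⇒ t (x - y) t[x-y]≈0
    where
    open ≈-Reasoning
    t[x-y]≈0 : t * (x - y) ≈ + 0
    t[x-y]≈0 = begin
      t * (x - y)        ≡⟨ ℤP.*-distribˡ-+ t x (- y) ⟩
      t * x + t * - y    ≈⟨ +-cong tx≈ty ≈-refl ⟩
      t * y + t * - y    ≡⟨ ℤP.*-distribˡ-+ t y (- y) ⟨
      t * (y - y)        ≡⟨ cong (t *_) (ℤP.+-inverseʳ y) ⟩
      t * + 0            ≡⟨ ℤP.*-zeroʳ t ⟩
      + 0                ∎
  ... | inj₁ t≈0   = ⊥-elim (t≉0 t≈0)
  ... | inj₂ x-y≈0 = +-cancelʳ (- y) (≈-trans x-y≈0 (≈-reflexive (sym (ℤP.+-inverseʳ y))))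

  coprime-to-p : ∀ n → ¬ + n ≈ + 0 → Coprime p n
  coprime-to-p n n≉0 (d∣p , d∣n) with prime⇒irreducible p-prime d∣p
  ... | inj₁ d≡1 = d≡1
  ... | inj₂ refl = ⊥-elim (n≉0 (∣⇒≈0 d∣n))

  ℕ-inverse : ∀ n → ¬ + n ≈ + 0 → ∃ λ u → + n * u ≈ + 1
  ℕ-inverse n n≉0 with coprime-Bézout (coprime-to-p n n≉0)
  ... | Bézout.+- x y eq = - + y , ≈-multiple (- + x) (begin
    + n * - + y                ≡⟨ rearrange (+ n) (+ y) ⟩
    + 1 - (+ 1 + + y * + n)    ≡⟨ cong (λ z → + 1 - z) (ℕ-cast 1 y n x p eq) ⟩
    + 1 - + x * + p            ≡⟨ cong (_+_ (+ 1)) (ℤP.neg-distribˡ-* (+ x) (+ p)) ⟩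
    + 1 + - + x * + p          ∎)
    where
    open ≡-Reasoning
    rearrange : ∀ n y → n * - y ≡ + 1 - (+ 1 + y * n)
    rearrange = solve-∀
    ℕ-cast : ∀ a b c d e → a ℕ.+ b ℕ.* c ≡ d ℕ.* e → + a + + b * + c ≡ + d * + e
    ℕ-cast a b c d e eq = trans (cong (_+_ (+ a)) (sym (ℤP.pos-* b c)))
                            (trans (sym (ℤP.pos-+ a (b ℕ.* c))) (trans (cong +_ eq) (ℤP.pos-* d e)))
  ... | Bézout.-+ x y eq = + y , ≈-multiple (+ x) (begin
    + n * + y                  ≡⟨ ℤP.pos-* n y ⟨
    + (n ℕ.* y)                ≡⟨ cong +_ (trans (ℕP.*-comm n y) (sym eq)) ⟩
    + (1 ℕ.+ x ℕ.* p)          ≡⟨ cong (_+_ (+ 1)) (ℤP.pos-* x p) ⟩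
    + 1 + + x * + p            ∎)
    where open ≡-Reasoning

  -- Opaque: only its specification is used, and unfolding the Bézout computation in types is ruinously slow.
  opaque
    inverse : ∀ x → ¬ x ≈ + 0 → ∃ λ u → x * u ≈ + 1
    inverse x x≉0 with ℕ-inverse (reduce x) (λ r≈0 → x≉0 (≈-trans (≈-sym (reduce≈ x)) r≈0))
    ... | u , ru≈1 = u , ≈-trans (*-cong (≈-sym (reduce≈ x)) ≈-refl) ru≈1

  infix 4 _≋_
  record _≋_ (P Q : Poly) : Set where
    constructor mk≋
    field coeff-≈ : ∀ i → coeff P i ≈ coeff Q i
  open _≋_ public

  ≋⇒≈[p] : ∀ {P Q} → P ≋ Q → P ≈[ p ] Q
  ≋⇒≈[p] P≋Q i = ≈⇒≡[p] (coeff-≈ P≋Q i)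

  ≈[p]⇒≋ : ∀ {P Q} → P ≈[ p ] Q → P ≋ Q
  ≈[p]⇒≋ P≈Q = mk≋ (λ i → mk≈ (P≈Q i))

  coeff-≡⇒≋ : ∀ {P Q} → (∀ i → coeff P i ≡ coeff Q i) → P ≋ Q
  coeff-≡⇒≋ eq = mk≋ (λ i → ≈-reflexive (eq i))

  ≋-refl : ∀ {P} → P ≋ P
  ≋-refl = mk≋ (λ _ → ≈-refl)

  ≋-sym : ∀ {P Q} → P ≋ Q → Q ≋ P
  ≋-sym P≋Q = mk≋ (λ i → ≈-sym (coeff-≈ P≋Q i))

  ≋-trans : ∀ {P Q R} → P ≋ Q → Q ≋ R → P ≋ R
  ≋-trans P≋Q Q≋R = mk≋ (λ i → ≈-trans (coeff-≈ P≋Q i) (coeff-≈ Q≋R i))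

  ≋-setoid : Setoid _ _
  ≋-setoid = record
    { Carrier = Poly ; _≈_ = _≋_
    ; isEquivalence = record { refl = ≋-refl ; sym = ≋-sym ; trans = ≋-trans } }

  module ≋-Reasoning = Relation.Binary.Reasoning.Setoid ≋-setoid

  conv-cong-≈ : ∀ {f f' g g' : ℕ → ℤ} → (∀ k → f k ≈ f' k) → (∀ k → g k ≈ g' k) →
                ∀ i → conv f g i ≈ conv f' g' i
  conv-cong-≈ f≈f' g≈g' zero    = *-cong (f≈f' 0) (g≈g' 0)
  conv-cong-≈ f≈f' g≈g' (suc i) = +-cong (*-cong (f≈f' 0) (g≈g' (suc i))) (conv-cong-≈ (λ k → f≈f' (suc k)) g≈g' i)

  +ₚ-cong : ∀ {P P' Q Q'} → P ≋ P' → Q ≋ Q' → P +ₚ Q ≋ P' +ₚ Q'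
  +ₚ-cong {P} {P'} {Q} {Q'} P≋P' Q≋Q' = mk≋ λ i → begin
    coeff (P +ₚ Q) i          ≡⟨ coeff-+ₚ P Q i ⟩
    coeff P i + coeff Q i     ≈⟨ +-cong (coeff-≈ P≋P' i) (coeff-≈ Q≋Q' i) ⟩
    coeff P' i + coeff Q' i   ≡⟨ coeff-+ₚ P' Q' i ⟨
    coeff (P' +ₚ Q') i        ∎
    where open ≈-Reasoning

  *ₚ-cong : ∀ {P P' Q Q'} → P ≋ P' → Q ≋ Q' → P *ₚ Q ≋ P' *ₚ Q'
  *ₚ-cong {P} {P'} {Q} {Q'} P≋P' Q≋Q' = mk≋ λ i → begin
    coeff (P *ₚ Q) i                  ≡⟨ coeff-*ₚ P Q i ⟩
    conv (coeff P) (coeff Q) i        ≈⟨ conv-cong-≈ (coeff-≈ P≋P') (coeff-≈ Q≋Q') i ⟩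
    conv (coeff P') (coeff Q') i      ≡⟨ coeff-*ₚ P' Q' i ⟨
    coeff (P' *ₚ Q') i                ∎
    where open ≈-Reasoning

  cst : ℤ → Poly
  cst c = c ∷ []

  -ₚ_ : Poly → Poly
  -ₚ P = map (ℤ.-1ℤ *_) P

  -ₚ-cong : ∀ {P Q} → P ≋ Q → -ₚ P ≋ -ₚ Q
  -ₚ-cong {P} {Q} P≋Q = mk≋ λ i → begin
    coeff (-ₚ P) i          ≡⟨ coeff-map ℤ.-1ℤ P i ⟩
    ℤ.-1ℤ * coeff P i       ≈⟨ *-cong (≈-refl {ℤ.-1ℤ}) (coeff-≈ P≋Q i) ⟩
    ℤ.-1ℤ * coeff Q i       ≡⟨ coeff-map ℤ.-1ℤ Q i ⟨
    coeff (-ₚ Q) i          ∎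
    where open ≈-Reasoning

  +ₚ-comm : ∀ P Q → P +ₚ Q ≋ Q +ₚ P
  +ₚ-comm P Q = coeff-≡⇒≋ λ i →
    trans (coeff-+ₚ P Q i) (trans (ℤP.+-comm (coeff P i) (coeff Q i)) (sym (coeff-+ₚ Q P i)))

  +ₚ-assoc : ∀ P Q R → (P +ₚ Q) +ₚ R ≋ P +ₚ (Q +ₚ R)
  +ₚ-assoc P Q R = coeff-≡⇒≋ λ i → begin
    coeff ((P +ₚ Q) +ₚ R) i              ≡⟨ coeff-+ₚ (P +ₚ Q) R i ⟩
    coeff (P +ₚ Q) i + coeff R i         ≡⟨ cong (_+ coeff R i) (coeff-+ₚ P Q i) ⟩
    coeff P i + coeff Q i + coeff R i    ≡⟨ ℤP.+-assoc (coeff P i) (coeff Q i) (coeff R i) ⟩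
    coeff P i + (coeff Q i + coeff R i)  ≡⟨ cong (_+_ (coeff P i)) (coeff-+ₚ Q R i) ⟨
    coeff P i + coeff (Q +ₚ R) i         ≡⟨ coeff-+ₚ P (Q +ₚ R) i ⟨
    coeff (P +ₚ (Q +ₚ R)) i              ∎
    where open ≡-Reasoning

  +ₚ-identityʳ : ∀ P → P +ₚ [] ≋ P
  +ₚ-identityʳ P = coeff-≡⇒≋ λ i → trans (coeff-+ₚ P [] i) (ℤP.+-identityʳ (coeff P i))

  -ₚ-inverseˡ : ∀ P → (-ₚ P) +ₚ P ≋ []
  -ₚ-inverseˡ P = coeff-≡⇒≋ λ i →
    trans (coeff-+ₚ (-ₚ P) P i) (trans (cong (_+ coeff P i) (coeff-map ℤ.-1ℤ P i)) (cancel (coeff P i)))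
    where
    cancel : ∀ x → ℤ.-1ℤ * x + x ≡ + 0
    cancel = solve-∀

  -ₚ-inverseʳ : ∀ P → P +ₚ (-ₚ P) ≋ []
  -ₚ-inverseʳ P = ≋-trans (+ₚ-comm P (-ₚ P)) (-ₚ-inverseˡ P)

  *ₚ-comm : ∀ P Q → P *ₚ Q ≋ Q *ₚ P
  *ₚ-comm P Q = coeff-≡⇒≋ λ i →
    trans (coeff-*ₚ P Q i) (trans (conv-comm (coeff P) (coeff Q) i) (sym (coeff-*ₚ Q P i)))

  *ₚ-assoc : ∀ P Q R → (P *ₚ Q) *ₚ R ≋ P *ₚ (Q *ₚ R)
  *ₚ-assoc P Q R = coeff-≡⇒≋ λ i → begin
    coeff ((P *ₚ Q) *ₚ R) i                          ≡⟨ coeff-*ₚ (P *ₚ Q) R i ⟩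
    conv (coeff (P *ₚ Q)) (coeff R) i                ≡⟨ conv-cong (coeff-*ₚ P Q) (λ _ → refl) i ⟩
    conv (conv (coeff P) (coeff Q)) (coeff R) i      ≡⟨ conv-assoc (coeff P) (coeff Q) (coeff R) i ⟩
    conv (coeff P) (conv (coeff Q) (coeff R)) i      ≡⟨ conv-cong (λ _ → refl) (coeff-*ₚ Q R) i ⟨
    conv (coeff P) (coeff (Q *ₚ R)) i                ≡⟨ coeff-*ₚ P (Q *ₚ R) i ⟨
    coeff (P *ₚ (Q *ₚ R)) i                          ∎
    where open ≡-Reasoning

  *ₚ-distribʳ : ∀ R P Q → (P +ₚ Q) *ₚ R ≋ (P *ₚ R) +ₚ (Q *ₚ R)
  *ₚ-distribʳ R P Q = coeff-≡⇒≋ λ i → begin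
    coeff ((P +ₚ Q) *ₚ R) i                              ≡⟨ coeff-*ₚ (P +ₚ Q) R i ⟩
    conv (coeff (P +ₚ Q)) (coeff R) i                    ≡⟨ conv-cong (coeff-+ₚ P Q) (λ _ → refl) i ⟩
    conv (λ k → coeff P k + coeff Q k) (coeff R) i       ≡⟨ conv-+ˡ (coeff P) (coeff Q) (coeff R) i ⟩
    conv (coeff P) (coeff R) i + conv (coeff Q) (coeff R) i
      ≡⟨ cong₂ _+_ (coeff-*ₚ P R i) (coeff-*ₚ Q R i) ⟨
    coeff (P *ₚ R) i + coeff (Q *ₚ R) i                  ≡⟨ coeff-+ₚ (P *ₚ R) (Q *ₚ R) i ⟨
    coeff ((P *ₚ R) +ₚ (Q *ₚ R)) i                       ∎
    where open ≡-Reasoning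

  *ₚ-distribˡ : ∀ R P Q → R *ₚ (P +ₚ Q) ≋ (R *ₚ P) +ₚ (R *ₚ Q)
  *ₚ-distribˡ R P Q =
    ≋-trans (*ₚ-comm R (P +ₚ Q)) (≋-trans (*ₚ-distribʳ R P Q) (+ₚ-cong (*ₚ-comm P R) (*ₚ-comm Q R)))

  *ₚ-identityˡ : ∀ P → oneₚ *ₚ P ≋ P
  *ₚ-identityˡ P = coeff-≡⇒≋ λ i → trans (coeff-*ₚ oneₚ P i) (conv-oneˡ (coeff P) i)

  *ₚ-identityʳ : ∀ P → P *ₚ oneₚ ≋ P
  *ₚ-identityʳ P = ≋-trans (*ₚ-comm P oneₚ) (*ₚ-identityˡ P)

  *ₚ-zeroʳ : ∀ P → P *ₚ [] ≋ []
  *ₚ-zeroʳ P = ≋-trans (*ₚ-comm P []) ≋-refl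

  polyRing : CommutativeRing _ _
  polyRing = record
    { Carrier = Poly ; _≈_ = _≋_ ; _+_ = _+ₚ_ ; _*_ = _*ₚ_ ; -_ = -ₚ_ ; 0# = [] ; 1# = oneₚ
    ; isCommutativeRing = record
      { isRing = record
        { +-isAbelianGroup = record
          { isGroup = record
            { isMonoid = record
              { isSemigroup = record
                { isMagma = record
                  { isEquivalence = Setoid.isEquivalence ≋-setoid
                  ; ∙-cong = +ₚ-cong }
                ; assoc = +ₚ-assoc }
              ; identity = (λ _ → ≋-refl) , +ₚ-identityʳ }
            ; inverse = -ₚ-inverseˡ , -ₚ-inverseʳ
            ; ⁻¹-cong = -ₚ-cong }
          ; comm = +ₚ-comm }
        ; *-cong = *ₚ-cong
        ; *-assoc = *ₚ-assoc
        ; *-identity = *ₚ-identityˡ , *ₚ-identityʳ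
        ; distrib = *ₚ-distribˡ , *ₚ-distribʳ }
      ; *-comm = *ₚ-comm } }

  cst-homomorphism : ℤ.+-*-rawRing -Raw-AlmostCommutative⟶ fromCommutativeRing polyRing
  cst-homomorphism = record
    { ⟦_⟧    = cst
    ; +-homo = λ _ _ → ≋-refl
    ; *-homo = λ a b → coeff-≡⇒≋ λ { zero → sym (ℤP.+-identityʳ (a * b)) ; (suc i) → refl }
    ; -‿homo = λ a → coeff-≡⇒≋ λ { zero → sym (ℤP.-1*i≡-i a) ; (suc i) → refl }
    ; 0-homo = coeff-≡⇒≋ λ { zero → refl ; (suc i) → refl }
    ; 1-homo = ≋-refl }

  cst-≟ : ∀ a b → Maybe (cst a ≋ cst b)
  cst-≟ a b with a ℤ.≟ b
  ... | yes refl = just ≋-refl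
  ... | no _     = nothing

  open Algebra.Solver.Ring ℤ.+-*-rawRing (fromCommutativeRing polyRing) cst-homomorphism cst-≟ public
    using (solve; con; _:+_; _:*_; :-_; _:=_)

  VanishesAbove : (ℕ → ℤ) → ℕ → Set
  VanishesAbove f m = ∀ k → m ℕ.< k → f k ≈ + 0

  -- Proofs of HasDeg P d are named P°d.
  record HasDeg (P : Poly) (d : ℕ) : Set where
    constructor mkDeg
    field
      leading≉0     : ¬ coeff P d ≈ + 0
      vanishes-above : VanishesAbove (coeff P) d
  open HasDeg public

  HasDegree⇒HasDeg : ∀ {P d} → HasDegree p P d → HasDeg P d
  HasDegree⇒HasDeg (lead , above) = mkDeg (λ z → lead (≈⇒≡[p] z)) (λ i d<i → mk≈ (above i d<i))

  HasDeg⇒HasDegree : ∀ {P d} → HasDeg P d → HasDegree p P d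
  HasDeg⇒HasDegree P°d = (λ z → leading≉0 P°d (mk≈ z)) , (λ i d<i → ≈⇒≡[p] (vanishes-above P°d i d<i))

  IsZero : Poly → Set
  IsZero P = P ≋ []

  zero⊎HasDeg : ∀ P → IsZero P ⊎ ∃ (HasDeg P)
  zero⊎HasDeg []       = inj₁ ≋-refl
  zero⊎HasDeg (c ∷ cs) with zero⊎HasDeg cs
  ... | inj₂ (d , cs°d) = inj₂ (suc d , mkDeg (leading≉0 cs°d) λ { (suc k) (s≤s d<k) → vanishes-above cs°d k d<k })
  ... | inj₁ cs≋0 with ≈0? c
  ...   | yes c≈0 = inj₁ (mk≋ λ { zero → c≈0 ; (suc k) → coeff-≈ cs≋0 k })
  ...   | no c≉0  = inj₂ (0 , mkDeg c≉0 λ { (suc k) _ → coeff-≈ cs≋0 k })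

  NonZeroPoly⇒HasDeg : ∀ {P} → NonZeroPoly p P → ∃ (HasDeg P)
  NonZeroPoly⇒HasDeg {P} (i , Pᵢ≢0) with zero⊎HasDeg P
  ... | inj₁ P≋0  = ⊥-elim (Pᵢ≢0 (≈⇒≡[p] (coeff-≈ P≋0 i)))
  ... | inj₂ P°d  = P°d

  HasDeg-resp : ∀ {P Q d} → P ≋ Q → HasDeg P d → HasDeg Q d
  HasDeg-resp P≋Q P°d =
    mkDeg (λ z → leading≉0 P°d (≈-trans (coeff-≈ P≋Q _) z))
          (λ k d<k → ≈-trans (≈-sym (coeff-≈ P≋Q k)) (vanishes-above P°d k d<k))

  HasDeg-unique : ∀ {P d e} → HasDeg P d → HasDeg P e → d ≡ e
  HasDeg-unique {d = d} {e} P°d P°e with ℕP.<-cmp d e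
  ... | tri< d<e _ _ = ⊥-elim (leading≉0 P°e (vanishes-above P°d e d<e))
  ... | tri≈ _ d≡e _ = d≡e
  ... | tri> _ _ e<d = ⊥-elim (leading≉0 P°d (vanishes-above P°e d e<d))

  HasDeg⇒≉0 : ∀ {P d} → HasDeg P d → ¬ IsZero P
  HasDeg⇒≉0 P°d P≋0 = leading≉0 P°d (coeff-≈ P≋0 _)

  *-≈0ʳ : ∀ x {y} → y ≈ + 0 → x * y ≈ + 0
  *-≈0ʳ x y≈0 = ≈-trans (*-cong (≈-refl {x}) y≈0) (≈-reflexive (ℤP.*-zeroʳ x))

  conv-≈0ˡ : ∀ {f} g → (∀ k → f k ≈ + 0) → ∀ i → conv f g i ≈ + 0
  conv-≈0ˡ {f} g f≈0 zero    = ≈-trans (*-cong (f≈0 0) (≈-refl {g 0})) ≈-refl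
  conv-≈0ˡ {f} g f≈0 (suc i) =
    +-cong (≈-trans (*-cong (f≈0 0) (≈-refl {g (suc i)})) ≈-refl) (conv-≈0ˡ g (λ k → f≈0 (suc k)) i)

  conv-constˡ : ∀ f g → VanishesAbove f 0 → ∀ k → conv f g k ≈ f 0 * g k
  conv-constˡ f g f°0 zero    = ≈-refl
  conv-constˡ f g f°0 (suc k) =
    ≈-trans (+-cong (≈-refl {f 0 * g (suc k)}) (conv-≈0ˡ g (λ j → f°0 (suc j) (s≤s z≤n)) k))
            (≈-reflexive (ℤP.+-identityʳ _))

  conv-top : ∀ m n f g → VanishesAbove f m → VanishesAbove g n →
             VanishesAbove (conv f g) (m ℕ.+ n) × conv f g (m ℕ.+ n) ≈ f m * g n
  conv-top zero    n f g f°0 g°n = (λ k n<k → ≈-trans (conv-constˡ f g f°0 k) (*-≈0ʳ (f 0) (g°n k n<k)))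
                                 , conv-constˡ f g f°0 n
  conv-top (suc m) n f g f°m g°n with conv-top m n (λ k → f (suc k)) g (λ k m<k → f°m (suc k) (s≤s m<k)) g°n
  ... | above , top = above' , top'
    where
    n<1+m+n : ∀ {k} → m ℕ.+ n ℕ.< k → n ℕ.< suc k
    n<1+m+n m+n<k = s≤s (ℕP.≤-trans (ℕP.m≤n+m n m) (ℕP.<⇒≤ m+n<k))
    above' : VanishesAbove (conv f g) (suc m ℕ.+ n)
    above' (suc k) (s≤s m+n<k) = +-cong (*-≈0ʳ (f 0) (g°n (suc k) (n<1+m+n m+n<k))) (above k m+n<k)
    top' : conv f g (suc m ℕ.+ n) ≈ f (suc m) * g n
    top' = ≈-trans (+-cong (*-≈0ʳ (f 0) (g°n (suc (m ℕ.+ n)) (s≤s (ℕP.m≤n+m n m)))) top)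
                   (≈-reflexive (ℤP.+-identityˡ _))

  HasDeg-*ₚ : ∀ {P Q m n} → HasDeg P m → HasDeg Q n → HasDeg (P *ₚ Q) (m ℕ.+ n)
  HasDeg-*ₚ {P} {Q} {m} {n} P°m Q°n with conv-top m n (coeff P) (coeff Q) (vanishes-above P°m) (vanishes-above Q°n)
  ... | above , top = mkDeg
    (λ z → *-≉0 (leading≉0 P°m) (leading≉0 Q°n)
             (≈-trans (≈-sym top) (≈-trans (≈-reflexive (sym (coeff-*ₚ P Q (m ℕ.+ n)))) z)))
    (λ k m+n<k → ≈-trans (≈-reflexive (coeff-*ₚ P Q k)) (above k m+n<k))

  *ₚ-zero⇒ : ∀ P Q → IsZero (P *ₚ Q) → IsZero P ⊎ IsZero Q
  *ₚ-zero⇒ P Q PQ≋0 with zero⊎HasDeg P | zero⊎HasDeg Q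
  ... | inj₁ P≋0 | _ = inj₁ P≋0
  ... | inj₂ _ | inj₁ Q≋0 = inj₂ Q≋0
  ... | inj₂ (m , P°m) | inj₂ (n , Q°n) = ⊥-elim (HasDeg⇒≉0 (HasDeg-*ₚ P°m Q°n) PQ≋0)

  infixl 6 _-ₚ_
  _-ₚ_ : Poly → Poly → Poly
  P -ₚ Q = P +ₚ (-ₚ Q)

  *ₚ-cancelˡ : ∀ {Q U V} → ¬ IsZero Q → Q *ₚ U ≋ Q *ₚ V → U ≋ V
  *ₚ-cancelˡ {Q} {U} {V} Q≉0 QU≋QV = [ (λ Q≋0 → ⊥-elim (Q≉0 Q≋0)) , U-V≋0⇒U≋V ]′ (*ₚ-zero⇒ Q (U -ₚ V) Q[U-V]≋0)
    where
    open ≋-Reasoning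
    Q[U-V]≋0 : IsZero (Q *ₚ (U -ₚ V))
    Q[U-V]≋0 = begin
      Q *ₚ (U -ₚ V)              ≈⟨ solve 3 (λ Q U V → Q :* (U :+ (:- V)) := (Q :* U) :+ (:- (Q :* V))) ≋-refl Q U V ⟩
      (Q *ₚ U) -ₚ (Q *ₚ V)       ≈⟨ +ₚ-cong QU≋QV ≋-refl ⟩
      (Q *ₚ V) -ₚ (Q *ₚ V)       ≈⟨ -ₚ-inverseʳ (Q *ₚ V) ⟩
      []                         ∎
    U-V≋0⇒U≋V : IsZero (U -ₚ V) → U ≋ V
    U-V≋0⇒U≋V U-V≋0 = begin
      U                  ≈⟨ solve 2 (λ U V → U := (U :+ (:- V)) :+ V) ≋-refl U V ⟩
      (U -ₚ V) +ₚ V      ≈⟨ +ₚ-cong U-V≋0 ≋-refl ⟩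
      V                  ∎

  infix 4 _∣ₚ_
  record _∣ₚ_ (G F : Poly) : Set where
    constructor divides
    field
      quotient : Poly
      equation : G *ₚ quotient ≋ F
  open _∣ₚ_ public

  ∣ₚ⇒DividesPoly : ∀ {G F} → G ∣ₚ F → DividesPoly p G F
  ∣ₚ⇒DividesPoly (divides Q GQ≋F) = Q , ≋⇒≈[p] GQ≋F

  ∣ₚ-refl : ∀ {G} → G ∣ₚ G
  ∣ₚ-refl {G} = divides oneₚ (*ₚ-identityʳ G)

  ∣ₚ-trans : ∀ {A B C} → A ∣ₚ B → B ∣ₚ C → A ∣ₚ C
  ∣ₚ-trans {A} (divides Q AQ≋B) (divides R BR≋C) =
    divides (Q *ₚ R) (≋-trans (≋-sym (*ₚ-assoc A Q R)) (≋-trans (*ₚ-cong AQ≋B ≋-refl) BR≋C))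

  ∣ₚ-respʳ : ∀ {G F F'} → F ≋ F' → G ∣ₚ F → G ∣ₚ F'
  ∣ₚ-respʳ F≋F' (divides Q GQ≋F) = divides Q (≋-trans GQ≋F F≋F')

  ∣ₚ-respˡ : ∀ {G G' F} → G ≋ G' → G ∣ₚ F → G' ∣ₚ F
  ∣ₚ-respˡ G≋G' (divides Q GQ≋F) = divides Q (≋-trans (*ₚ-cong (≋-sym G≋G') ≋-refl) GQ≋F)

  ∣ₚ-*ʳ : ∀ {G F} H → G ∣ₚ F → G ∣ₚ F *ₚ H
  ∣ₚ-*ʳ {G} H (divides Q GQ≋F) = divides (Q *ₚ H) (≋-trans (≋-sym (*ₚ-assoc G Q H)) (*ₚ-cong GQ≋F ≋-refl))

  ∣ₚ-*ʳ-self : ∀ G H → G ∣ₚ G *ₚ H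
  ∣ₚ-*ʳ-self G H = divides H ≋-refl

  ∣ₚ-*ₚ-congˡ : ∀ {G F} H → G ∣ₚ F → H *ₚ G ∣ₚ H *ₚ F
  ∣ₚ-*ₚ-congˡ {G} H (divides Q GQ≋F) = divides Q (≋-trans (*ₚ-assoc H G Q) (*ₚ-cong (≋-refl {H}) GQ≋F))

  ∣ₚ-+ₚ : ∀ {G A B} → G ∣ₚ A → G ∣ₚ B → G ∣ₚ A +ₚ B
  ∣ₚ-+ₚ {G} (divides Q GQ≋A) (divides R GR≋B) = divides (Q +ₚ R) (≋-trans (*ₚ-distribˡ G Q R) (+ₚ-cong GQ≋A GR≋B))

  ∣ₚ⇒deg≤ : ∀ {G F m n} → G ∣ₚ F → HasDeg G m → HasDeg F n → m ℕ.≤ n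
  ∣ₚ⇒deg≤ {G} {F} {m} {n} (divides Q GQ≋F) G°m F°n with zero⊎HasDeg Q
  ... | inj₁ Q≋0 = ⊥-elim (HasDeg⇒≉0 F°n (≋-trans (≋-sym GQ≋F) (≋-trans (*ₚ-cong (≋-refl {G}) Q≋0) (*ₚ-zeroʳ G))))
  ... | inj₂ (k , Q°k) = subst (m ℕ.≤_) (HasDeg-unique (HasDeg-resp GQ≋F (HasDeg-*ₚ G°m Q°k)) F°n) (ℕP.m≤m+n m k)

  Xₚ : Poly
  Xₚ = + 0 ∷ + 1 ∷ []

  ∷-cong : ∀ {c c' P P'} → c ≈ c' → P ≋ P' → c ∷ P ≋ c' ∷ P'
  ∷-cong c≈c' P≋P' = mk≋ λ { zero → c≈c' ; (suc i) → coeff-≈ P≋P' i }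

  zero-cst : + 0 ∷ [] ≋ []
  zero-cst = mk≋ λ { zero → ≈-refl ; (suc i) → ≈-refl }

  map-*≋cst-*ₚ : ∀ a P → map (a *_) P ≋ cst a *ₚ P
  map-*≋cst-*ₚ a P = ≋-sym (begin
    map (a *_) P +ₚ (+ 0 ∷ [])   ≈⟨ +ₚ-cong (≋-refl {map (a *_) P}) zero-cst ⟩
    map (a *_) P +ₚ []           ≈⟨ +ₚ-identityʳ (map (a *_) P) ⟩
    map (a *_) P                 ∎)
    where open ≋-Reasoning

  Xₚ-*ₚ : ∀ R → Xₚ *ₚ R ≋ + 0 ∷ R
  Xₚ-*ₚ R = begin
    map (+ 0 *_) R +ₚ (+ 0 ∷ oneₚ *ₚ R)   ≈⟨ +ₚ-cong {map (+ 0 *_) R} {[]} (coeff-≡⇒≋ (coeff-map (+ 0) R)) ≋-refl ⟩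
    + 0 ∷ oneₚ *ₚ R                       ≈⟨ ∷-cong ≈-refl (*ₚ-identityˡ R) ⟩
    + 0 ∷ R                               ∎
    where open ≋-Reasoning

  ∷-≋ : ∀ c R → c ∷ R ≋ cst c +ₚ Xₚ *ₚ R
  ∷-≋ c R = ≋-sym (begin
    cst c +ₚ Xₚ *ₚ R        ≈⟨ +ₚ-cong (≋-refl {cst c}) (Xₚ-*ₚ R) ⟩
    c + + 0 ∷ R             ≈⟨ ∷-cong (≈-reflexive (ℤP.+-identityʳ c)) ≋-refl ⟩
    c ∷ R                   ∎)
    where open ≋-Reasoning

  cst-cong : ∀ {a b} → a ≈ b → cst a ≋ cst b
  cst-cong a≈b = ∷-cong a≈b ≋-refl

  cst-*ₚ : ∀ a b → cst a *ₚ cst b ≋ cst (a * b)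
  cst-*ₚ a b = coeff-≡⇒≋ λ { zero → ℤP.+-identityʳ (a * b) ; (suc k) → refl }

  cst-neg : ∀ a → cst (- a) ≋ -ₚ cst a
  cst-neg a = coeff-≡⇒≋ λ { zero → sym (ℤP.-1*i≡-i a) ; (suc i) → refl }

  cst-≈0 : ∀ {a} → a ≈ + 0 → cst a ≋ []
  cst-≈0 a≈0 = mk≋ λ { zero → a≈0 ; (suc i) → ≈-refl }

  HasDeg-0⇒cst : ∀ {S} → HasDeg S 0 → S ≋ cst (coeff S 0)
  HasDeg-0⇒cst S°0 = mk≋ λ { zero → ≈-refl ; (suc k) → vanishes-above S°0 (suc k) (s≤s z≤n) }

  HasDeg-0⇒unit : ∀ {S} → HasDeg S 0 → ∃ λ T → S *ₚ T ≋ oneₚ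
  HasDeg-0⇒unit {S} S°0 = unit (inverse (coeff S 0) (leading≉0 S°0))
    where
    open ≋-Reasoning
    unit : (∃ λ t → coeff S 0 * t ≈ + 1) → ∃ λ T → S *ₚ T ≋ oneₚ
    unit (t , st≈1) = cst t , (begin
      S *ₚ cst t                  ≈⟨ *ₚ-cong (HasDeg-0⇒cst S°0) (≋-refl {cst t}) ⟩
      cst (coeff S 0) *ₚ cst t    ≈⟨ cst-*ₚ (coeff S 0) t ⟩
      cst (coeff S 0 * t)         ≈⟨ cst-cong st≈1 ⟩
      oneₚ                        ∎)

  HasDeg-0-∣ₚ : ∀ {S} → HasDeg S 0 → ∀ R → S ∣ₚ R
  HasDeg-0-∣ₚ {S} S°0 R = divides (T *ₚ R) (begin
    S *ₚ (T *ₚ R)     ≈⟨ ≋-sym (*ₚ-assoc S T R) ⟩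
    (S *ₚ T) *ₚ R     ≈⟨ *ₚ-cong (proj₂ (HasDeg-0⇒unit S°0)) (≋-refl {R}) ⟩
    oneₚ *ₚ R         ≈⟨ *ₚ-identityˡ R ⟩
    R                 ∎)
    where
    open ≋-Reasoning
    T : Poly
    T = proj₁ (HasDeg-0⇒unit S°0)

  VanishesFrom : ℕ → Poly → Set
  VanishesFrom m R = ∀ k → m ℕ.≤ k → coeff R k ≈ + 0

  VanishesFrom⇒deg< : ∀ {R m k} → VanishesFrom m R → HasDeg R k → k ℕ.< m
  VanishesFrom⇒deg< {R} {m} {k} small R°k with k ℕ.<? m
  ... | yes k<m = k<m
  ... | no  k≮m = ⊥-elim (leading≉0 R°k (small k (ℕP.≮⇒≥ k≮m)))

  division-step : ∀ X D q r C K → C +ₚ X *ₚ (D *ₚ q +ₚ r) ≋ D *ₚ (X *ₚ q +ₚ K) +ₚ ((C +ₚ X *ₚ r) +ₚ (-ₚ K) *ₚ D)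
  division-step = solve 6 (λ X D q r C K → C :+ X :* (D :* q :+ r) := D :* (X :* q :+ K) :+ ((C :+ X :* r) :+ (:- K) :* D)) ≋-refl

  record Division (D : Poly) (m : ℕ) (P : Poly) : Set where
    constructor division
    field
      quot rem : Poly
      split    : P ≋ D *ₚ quot +ₚ rem
      rem-small : VanishesFrom m rem

  cancel-leading : ∀ {D m u} → HasDeg D m → coeff D m * u ≈ + 1 → ∀ R → VanishesAbove (coeff R) m →
                   VanishesFrom m (R +ₚ map ((- (coeff R m * u)) *_) D)
  cancel-leading {D} {m} {u} D°m lead·u≈1 R R°m k m≤k with ℕP.m≤n⇒m<n∨m≡n m≤k
  ... | inj₁ m<k = ≈-trans (≈-reflexive (coeff-R' k)) (+-cong (R°m k m<k) (*-≈0ʳ (- (coeff R m * u)) (vanishes-above D°m k m<k)))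
    where
    coeff-R' : ∀ k → coeff (R +ₚ map ((- (coeff R m * u)) *_) D) k ≡ coeff R k + (- (coeff R m * u)) * coeff D k
    coeff-R' k = trans (coeff-+ₚ R (map ((- (coeff R m * u)) *_) D) k) (cong (_+_ (coeff R k)) (coeff-map (- (coeff R m * u)) D k))
  ... | inj₂ refl = begin
    coeff (R +ₚ map ((- (e * u)) *_) D) m   ≡⟨ coeff-+ₚ R (map ((- (e * u)) *_) D) m ⟩
    e + coeff (map ((- (e * u)) *_) D) m    ≡⟨ cong (_+_ e) (coeff-map (- (e * u)) D m) ⟩
    e + (- (e * u)) * coeff D m             ≡⟨ regroup e u (coeff D m) ⟩
    e + (- e) * (coeff D m * u)             ≈⟨ +-cong (≈-refl {e}) (*-cong (≈-refl { - e}) lead·u≈1) ⟩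
    e + (- e) * + 1                         ≡⟨ cancel e ⟩
    + 0                                     ∎
    where
    open ≈-Reasoning
    e : ℤ
    e = coeff R m
    regroup : ∀ e u l → e + (- (e * u)) * l ≡ e + (- e) * (l * u)
    regroup = solve-∀
    cancel : ∀ e → e + (- e) * + 1 ≡ + 0
    cancel = solve-∀

  divide : ∀ {D m} → HasDeg D m → ∀ P → Division D m P
  divide {D} {m} D°m = go
    where
    u : ℤ
    u = proj₁ (inverse (coeff D m) (leading≉0 D°m))
    lead·u≈1 : coeff D m * u ≈ + 1
    lead·u≈1 = proj₂ (inverse (coeff D m) (leading≉0 D°m))

    go : ∀ P → Division D m P
    go [] = division [] [] (≋-sym (≋-trans (+ₚ-identityʳ (D *ₚ [])) (*ₚ-zeroʳ D))) (λ _ _ → ≈-refl)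
    go (c ∷ cs) with go cs
    ... | division q r split small = division q' r' split' (cancel-leading D°m lead·u≈1 (c ∷ r) r°m)
      where
      κ : ℤ
      κ = coeff (c ∷ r) m * u
      q' : Poly
      q' = Xₚ *ₚ q +ₚ cst κ
      r' : Poly
      r' = (c ∷ r) +ₚ map ((- κ) *_) D
      r°m : VanishesAbove (coeff (c ∷ r)) m
      r°m (suc k) (s≤s m≤k) = small k m≤k
      split' : c ∷ cs ≋ D *ₚ q' +ₚ r'
      split' = begin
        c ∷ cs                                                   ≈⟨ ∷-≋ c cs ⟩
        cst c +ₚ Xₚ *ₚ cs                                        ≈⟨ +ₚ-cong (≋-refl {cst c}) (*ₚ-cong (≋-refl {Xₚ}) split) ⟩
        cst c +ₚ Xₚ *ₚ (D *ₚ q +ₚ r)                             ≈⟨ division-step Xₚ D q r (cst c) (cst κ) ⟩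
        D *ₚ q' +ₚ ((cst c +ₚ Xₚ *ₚ r) +ₚ (-ₚ cst κ) *ₚ D)       ≈⟨ +ₚ-cong (≋-refl {D *ₚ q'}) (+ₚ-cong (≋-sym (∷-≋ c r)) neg-κD) ⟩
        D *ₚ q' +ₚ r'                                            ∎
        where
        open ≋-Reasoning
        neg-κD : (-ₚ cst κ) *ₚ D ≋ map ((- κ) *_) D
        neg-κD = ≋-sym (≋-trans (map-*≋cst-*ₚ (- κ) D) (*ₚ-cong (cst-neg κ) (≋-refl {D})))

  ∣ₚ∧small⇒zero : ∀ {D m R} → HasDeg D m → D ∣ₚ R → VanishesFrom m R → IsZero R
  ∣ₚ∧small⇒zero {D} {m} {R} D°m (divides Q DQ≋R) small with zero⊎HasDeg Q
  ... | inj₁ Q≋0 = ≋-trans (≋-sym DQ≋R) (≋-trans (*ₚ-cong (≋-refl {D}) Q≋0) (*ₚ-zeroʳ D))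
  ... | inj₂ (j , Q°j) = ⊥-elim (ℕP.<⇒≱ (VanishesFrom⇒deg< small R°m+j) (ℕP.m≤m+n m j))
    where
    R°m+j : HasDeg R (m ℕ.+ j)
    R°m+j = HasDeg-resp DQ≋R (HasDeg-*ₚ D°m Q°j)

  ∣ₚ-+ₚ-cancelˡ : ∀ {G A B} → G ∣ₚ A → G ∣ₚ A +ₚ B → G ∣ₚ B
  ∣ₚ-+ₚ-cancelˡ {G} {A} {B} (divides Q GQ≋A) (divides R GR≋A+B) = divides (R -ₚ Q) (begin
    G *ₚ (R -ₚ Q)             ≈⟨ solve 3 (λ G R Q → G :* (R :+ (:- Q)) := G :* R :+ (:- (G :* Q))) ≋-refl G R Q ⟩
    G *ₚ R -ₚ G *ₚ Q          ≈⟨ +ₚ-cong GR≋A+B (-ₚ-cong GQ≋A) ⟩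
    (A +ₚ B) -ₚ A             ≈⟨ solve 2 (λ A B → (A :+ B) :+ (:- A) := B) ≋-refl A B ⟩
    B                         ∎)
    where open ≋-Reasoning

  ∣ₚ? : ∀ {D m} → HasDeg D m → ∀ P → Dec (D ∣ₚ P)
  ∣ₚ? {D} D°m P with divide D°m P
  ... | division q r split small with zero⊎HasDeg r
  ...   | inj₁ r≋0 = yes (divides q (≋-sym (≋-trans split (≋-trans (+ₚ-cong (≋-refl {D *ₚ q}) r≋0) (+ₚ-identityʳ (D *ₚ q))))))
  ...   | inj₂ (_ , r°k) = no λ D∣P →
    HasDeg⇒≉0 r°k (∣ₚ∧small⇒zero D°m (∣ₚ-+ₚ-cancelˡ (∣ₚ-*ʳ-self D q) (∣ₚ-respʳ split D∣P)) small)

  cofactor-deg-0 : ∀ {E S Q m} → E *ₚ S ≋ Q → HasDeg E m → HasDeg Q m → HasDeg S 0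
  cofactor-deg-0 {E} {S} {Q} {m} ES≋Q E°m Q°m with zero⊎HasDeg S
  ... | inj₁ S≋0 = ⊥-elim (HasDeg⇒≉0 Q°m (≋-trans (≋-sym ES≋Q) (≋-trans (*ₚ-cong (≋-refl {E}) S≋0) (*ₚ-zeroʳ E))))
  ... | inj₂ (j , S°j) = subst (HasDeg S) j≡0 S°j
    where
    j≡0 : j ≡ 0
    j≡0 = ℕP.+-cancelˡ-≡ m j 0 (trans (HasDeg-unique (HasDeg-resp ES≋Q (HasDeg-*ₚ E°m S°j)) Q°m) (sym (ℕP.+-identityʳ m)))

  ∣ₚ-same-deg⇒∣ₚ : ∀ {E Q m} → E ∣ₚ Q → HasDeg E m → HasDeg Q m → Q ∣ₚ E
  ∣ₚ-same-deg⇒∣ₚ {E} {Q} {m} (divides S ES≋Q) E°m Q°m = divides T (begin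
    Q *ₚ T             ≈⟨ *ₚ-cong (≋-sym ES≋Q) (≋-refl {T}) ⟩
    (E *ₚ S) *ₚ T      ≈⟨ *ₚ-assoc E S T ⟩
    E *ₚ (S *ₚ T)      ≈⟨ *ₚ-cong (≋-refl {E}) (proj₂ (HasDeg-0⇒unit S°0)) ⟩
    E *ₚ oneₚ          ≈⟨ *ₚ-identityʳ E ⟩
    E                  ∎)
    where
    open ≋-Reasoning
    S°0 : HasDeg S 0
    S°0 = cofactor-deg-0 ES≋Q E°m Q°m
    T : Poly
    T = proj₁ (HasDeg-0⇒unit S°0)

  record Irreducible (Q : Poly) : Set where
    field
      deg        : ℕ
      has-deg    : HasDeg Q deg
      deg≥1      : 1 ℕ.≤ deg
      divisor-deg : ∀ {E e} → E ∣ₚ Q → HasDeg E e → e ≡ 0 ⊎ e ≡ deg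
  open Irreducible public

  refute-minimal : (W : ℕ → Set) → (∀ n → W n → (∀ {k} → k ℕ.< n → ¬ W k) → ⊥) → ∀ n → ¬ W n
  refute-minimal W no-minimal = <-rec (λ n → ¬ W n) (λ n smaller w → no-minimal n w smaller)

  record InIdeal (Q U F : Poly) : Set where
    constructor combination
    field
      coefQ coefU : Poly
      equation : F ≋ Q *ₚ coefQ +ₚ U *ₚ coefU

  InIdeal-remainder : ∀ {Q U D F} → InIdeal Q U D → InIdeal Q U F → ∀ q r → F ≋ D *ₚ q +ₚ r → InIdeal Q U r
  InIdeal-remainder {Q} {U} {D} {F} (combination a b D≋) (combination a' b' F≋) q r F≋Dq+r =
    combination (a' -ₚ a *ₚ q) (b' -ₚ b *ₚ q) (begin
      r                                              ≈⟨ solve 2 (λ A r → r := (A :+ r) :+ (:- A)) ≋-refl (D *ₚ q) r ⟩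
      (D *ₚ q +ₚ r) -ₚ D *ₚ q                        ≈⟨ +ₚ-cong (≋-sym F≋Dq+r) (≋-refl { -ₚ (D *ₚ q)}) ⟩
      F -ₚ D *ₚ q                                    ≈⟨ +ₚ-cong F≋ (-ₚ-cong (*ₚ-cong D≋ (≋-refl {q}))) ⟩
      (Q *ₚ a' +ₚ U *ₚ b') -ₚ (Q *ₚ a +ₚ U *ₚ b) *ₚ q
        ≈⟨ solve 7 (λ Q U a b a' b' q → (Q :* a' :+ U :* b') :+ (:- ((Q :* a :+ U :* b) :* q))
                                      := Q :* (a' :+ (:- (a :* q))) :+ U :* (b' :+ (:- (b :* q)))) ≋-refl Q U a b a' b' q ⟩
      Q *ₚ (a' -ₚ a *ₚ q) +ₚ U *ₚ (b' -ₚ b *ₚ q)     ∎)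
    where open ≋-Reasoning

  -- The remainder on division by D lies in the ideal and has smaller degree, so it vanishes.
  least-InIdeal-∣ₚ : ∀ {Q U D n} → InIdeal Q U D → HasDeg D n →
                     (∀ {k} → k ℕ.< n → ∀ E → InIdeal Q U E → ¬ HasDeg E k) → ∀ {F} → InIdeal Q U F → D ∣ₚ F
  least-InIdeal-∣ₚ {D = D} D∈I D°n least {F} F∈I with divide D°n F
  ... | division q r split small with zero⊎HasDeg r
  ...   | inj₁ r≋0 = divides q (≋-sym (≋-trans split (≋-trans (+ₚ-cong (≋-refl {D *ₚ q}) r≋0) (+ₚ-identityʳ (D *ₚ q)))))
  ...   | inj₂ (k , r°k) = ⊥-elim (least (VanishesFrom⇒deg< small r°k) r (InIdeal-remainder D∈I F∈I q r split) r°k)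

  InIdeal-left : ∀ Q U → InIdeal Q U Q
  InIdeal-left Q U = combination oneₚ (cst (+ 0)) (solve 2 (λ Q U → Q := Q :* con (+ 1) :+ U :* con (+ 0)) ≋-refl Q U)

  InIdeal-right : ∀ Q U → InIdeal Q U U
  InIdeal-right Q U = combination (cst (+ 0)) oneₚ (solve 2 (λ Q U → U := Q :* con (+ 0) :+ U :* con (+ 1)) ≋-refl Q U)

  unit-combination : ∀ V Q U a b T → Q *ₚ (a *ₚ (V *ₚ T)) +ₚ (U *ₚ V) *ₚ (b *ₚ T) ≋ V *ₚ ((Q *ₚ a +ₚ U *ₚ b) *ₚ T)
  unit-combination = solve 6 (λ V Q U a b T → Q :* (a :* (V :* T)) :+ (U :* V) :* (b :* T) := V :* ((Q :* a :+ U :* b) :* T)) ≋-refl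

  -- V = Q·(a V D⁻¹) + (U V)·(b D⁻¹) when D = Q a + U b is a unit.
  unit-InIdeal⇒∣ₚ : ∀ {Q U V D} → InIdeal Q U D → HasDeg D 0 → Q ∣ₚ U *ₚ V → Q ∣ₚ V
  unit-InIdeal⇒∣ₚ {Q} {U} {V} {D} (combination a b D≋) D°0 Q∣UV =
    ∣ₚ-respʳ V≋ (∣ₚ-+ₚ (∣ₚ-*ʳ-self Q (a *ₚ (V *ₚ T))) (∣ₚ-*ʳ (b *ₚ T) Q∣UV))
    where
    open ≋-Reasoning
    T : Poly
    T = proj₁ (HasDeg-0⇒unit D°0)
    V≋ : Q *ₚ (a *ₚ (V *ₚ T)) +ₚ (U *ₚ V) *ₚ (b *ₚ T) ≋ V
    V≋ = begin
      Q *ₚ (a *ₚ (V *ₚ T)) +ₚ (U *ₚ V) *ₚ (b *ₚ T)   ≈⟨ unit-combination V Q U a b T ⟩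
      V *ₚ ((Q *ₚ a +ₚ U *ₚ b) *ₚ T)                 ≈⟨ *ₚ-cong (≋-refl {V}) (*ₚ-cong (≋-sym D≋) (≋-refl {T})) ⟩
      V *ₚ (D *ₚ T)                                  ≈⟨ *ₚ-cong (≋-refl {V}) (proj₂ (HasDeg-0⇒unit D°0)) ⟩
      V *ₚ oneₚ                                      ≈⟨ *ₚ-identityʳ V ⟩
      V                                              ∎

  -- A least-degree element D of the ideal (Q, U) divides Q, so it is a unit or an associate of Q.
  irreducible-∤-∤ : ∀ {Q U V} → Irreducible Q → Q ∣ₚ U *ₚ V → ¬ Q ∣ₚ U → ¬ Q ∣ₚ V → ⊥
  irreducible-∤-∤ {Q} {U} {V} Q-irr Q∣UV Q∤U Q∤V =
    refute-minimal IdealElementOfDeg no-least (deg Q-irr) (Q , InIdeal-left Q U , has-deg Q-irr)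
    where
    IdealElementOfDeg : ℕ → Set
    IdealElementOfDeg n = ∃ λ D → InIdeal Q U D × HasDeg D n
    no-least : ∀ n → IdealElementOfDeg n → (∀ {k} → k ℕ.< n → ¬ IdealElementOfDeg k) → ⊥
    no-least n (D , D∈I , D°n) smaller = unit-or-associate (divisor-deg Q-irr D∣Q D°n)
      where
      D∣ : ∀ {F} → InIdeal Q U F → D ∣ₚ F
      D∣ = least-InIdeal-∣ₚ D∈I D°n (λ k<n E E∈I E°k → smaller k<n (E , E∈I , E°k))
      D∣Q : D ∣ₚ Q
      D∣Q = D∣ (InIdeal-left Q U)
      unit-or-associate : n ≡ 0 ⊎ n ≡ deg Q-irr → ⊥
      unit-or-associate (inj₁ refl) = Q∤V (unit-InIdeal⇒∣ₚ D∈I D°n Q∣UV)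
      unit-or-associate (inj₂ refl) = Q∤U (∣ₚ-trans (∣ₚ-same-deg⇒∣ₚ D∣Q D°n (has-deg Q-irr)) (D∣ (InIdeal-right Q U)))

  IsPrimeₚ : Poly → Set
  IsPrimeₚ Q = ∀ {U V} → Q ∣ₚ U *ₚ V → Q ∣ₚ U ⊎ Q ∣ₚ V

  irreducible⇒prime : ∀ {Q} → Irreducible Q → IsPrimeₚ Q
  irreducible⇒prime {Q} Q-irr {U} {V} Q∣UV = decide (∣ₚ? (has-deg Q-irr) U) (∣ₚ? (has-deg Q-irr) V)
    where
    decide : Dec (Q ∣ₚ U) → Dec (Q ∣ₚ V) → Q ∣ₚ U ⊎ Q ∣ₚ V
    decide (yes Q∣U) _         = inj₁ Q∣U
    decide (no _)    (yes Q∣V) = inj₂ Q∣V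
    decide (no Q∤U)  (no Q∤V)  = ⊥-elim (irreducible-∤-∤ Q-irr Q∣UV Q∤U Q∤V)

  irreducible-factor : ∀ {F n} → HasDeg F n → 1 ℕ.≤ n → ¬ (∀ Q → Irreducible Q → ¬ Q ∣ₚ F)
  irreducible-factor {F} {n} F°n n≥1 no-factor = refute-minimal NonconstantDivisor no-least n (F , ∣ₚ-refl , F°n , n≥1)
    where
    NonconstantDivisor : ℕ → Set
    NonconstantDivisor k = ∃ λ E → E ∣ₚ F × HasDeg E k × 1 ℕ.≤ k
    -- a nonconstant divisor of least degree is irreducible
    no-least : ∀ m → NonconstantDivisor m → (∀ {k} → k ℕ.< m → ¬ NonconstantDivisor k) → ⊥
    no-least m (E , E∣F , E°m , m≥1) smaller = no-factor E E-irr E∣F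
      where
      divisor-deg' : ∀ {G g} → G ∣ₚ E → HasDeg G g → g ≡ 0 ⊎ g ≡ m
      divisor-deg' {g = zero}  _   _   = inj₁ refl
      divisor-deg' {g = suc g} G∣E G°g with ℕP.m≤n⇒m<n∨m≡n (∣ₚ⇒deg≤ G∣E G°g E°m)
      ... | inj₂ g≡m = inj₂ g≡m
      ... | inj₁ g<m = ⊥-elim (smaller g<m (_ , ∣ₚ-trans G∣E E∣F , G°g , s≤s z≤n))
      E-irr : Irreducible E
      E-irr = record { deg = m ; has-deg = E°m ; deg≥1 = m≥1 ; divisor-deg = divisor-deg' }

  oneₚ-deg : HasDeg oneₚ 0
  oneₚ-deg = mkDeg (1≤n<p⇒≉0 (s≤s z≤n) 1<p) (λ { (suc k) _ → ≈-refl })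

  irreducible-nonunit : ∀ {Q} → Irreducible Q → ¬ Q ∣ₚ oneₚ
  irreducible-nonunit Q-irr Q∣1 = ℕP.<⇒≱ (deg≥1 Q-irr) (∣ₚ⇒deg≤ Q∣1 (has-deg Q-irr) oneₚ-deg)

  tail-≋ : ∀ {c c' P P'} → c ∷ P ≋ c' ∷ P' → P ≋ P'
  tail-≋ e = mk≋ (λ i → coeff-≈ e (suc i))

  tail-zero : ∀ {c P} → IsZero (c ∷ P) → IsZero P
  tail-zero e = mk≋ (λ i → coeff-≈ e (suc i))

  compose-zero : ∀ {P} G → IsZero P → IsZero (compose P G)
  compose-zero {[]}     G P≋0 = ≋-refl
  compose-zero {c ∷ cs} G P≋0 = begin
    cst c +ₚ G *ₚ compose cs G   ≈⟨ +ₚ-cong (cst-≈0 (coeff-≈ P≋0 0)) (*ₚ-cong (≋-refl {G}) (compose-zero G (tail-zero P≋0))) ⟩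
    G *ₚ []                      ≈⟨ *ₚ-zeroʳ G ⟩
    []                           ∎
    where open ≋-Reasoning

  compose-congˡ : ∀ {P P'} G → P ≋ P' → compose P G ≋ compose P' G
  compose-congˡ {[]}     {[]}       G e = ≋-refl
  compose-congˡ {[]}     {c' ∷ cs'} G e = ≋-sym (compose-zero G (≋-sym e))
  compose-congˡ {c ∷ cs} {[]}       G e = compose-zero G e
  compose-congˡ {c ∷ cs} {c' ∷ cs'} G e =
    +ₚ-cong (cst-cong (coeff-≈ e 0)) (*ₚ-cong (≋-refl {G}) (compose-congˡ G (tail-≋ e)))

  compose-congʳ : ∀ P {G G'} → G ≋ G' → compose P G ≋ compose P G'
  compose-congʳ []       e = ≋-refl
  compose-congʳ (c ∷ cs) e = +ₚ-cong (≋-refl {cst c}) (*ₚ-cong e (compose-congʳ cs e))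

  compose-+ₚ : ∀ P Q G → compose (P +ₚ Q) G ≋ compose P G +ₚ compose Q G
  compose-+ₚ []      Q       G = ≋-refl
  compose-+ₚ (a ∷ P) []      G = ≋-sym (+ₚ-identityʳ (compose (a ∷ P) G))
  compose-+ₚ (a ∷ P) (b ∷ Q) G = begin
    cst (a + b) +ₚ G *ₚ compose (P +ₚ Q) G
      ≈⟨ +ₚ-cong (≋-refl {cst (a + b)}) (*ₚ-cong (≋-refl {G}) (compose-+ₚ P Q G)) ⟩
    (cst a +ₚ cst b) +ₚ G *ₚ (compose P G +ₚ compose Q G)
      ≈⟨ solve 5 (λ A B G P Q → (A :+ B) :+ G :* (P :+ Q) := (A :+ G :* P) :+ (B :+ G :* Q)) ≋-refl
                 (cst a) (cst b) G (compose P G) (compose Q G) ⟩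
    (cst a +ₚ G *ₚ compose P G) +ₚ (cst b +ₚ G *ₚ compose Q G)
      ∎
    where open ≋-Reasoning

  compose-map : ∀ a Q G → compose (map (a *_) Q) G ≋ cst a *ₚ compose Q G
  compose-map a []      G = ≋-sym (*ₚ-zeroʳ (cst a))
  compose-map a (b ∷ Q) G = begin
    cst (a * b) +ₚ G *ₚ compose (map (a *_) Q) G
      ≈⟨ +ₚ-cong (≋-sym (cst-*ₚ a b)) (*ₚ-cong (≋-refl {G}) (compose-map a Q G)) ⟩
    cst a *ₚ cst b +ₚ G *ₚ (cst a *ₚ compose Q G)
      ≈⟨ solve 4 (λ A B G R → A :* B :+ G :* (A :* R) := A :* (B :+ G :* R)) ≋-refl (cst a) (cst b) G (compose Q G) ⟩
    cst a *ₚ (cst b +ₚ G *ₚ compose Q G)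
      ∎
    where open ≋-Reasoning

  compose-*ₚ : ∀ P Q G → compose (P *ₚ Q) G ≋ compose P G *ₚ compose Q G
  compose-*ₚ []      Q G = ≋-refl
  compose-*ₚ (a ∷ P) Q G = begin
    compose (map (a *_) Q +ₚ (+ 0 ∷ P *ₚ Q)) G
      ≈⟨ compose-+ₚ (map (a *_) Q) (+ 0 ∷ (P *ₚ Q)) G ⟩
    compose (map (a *_) Q) G +ₚ (cst (+ 0) +ₚ G *ₚ compose (P *ₚ Q) G)
      ≈⟨ +ₚ-cong (compose-map a Q G) (+ₚ-cong zero-cst (*ₚ-cong (≋-refl {G}) (compose-*ₚ P Q G))) ⟩
    cst a *ₚ compose Q G +ₚ G *ₚ (compose P G *ₚ compose Q G)
      ≈⟨ solve 4 (λ A G P Q → A :* Q :+ G :* (P :* Q) := (A :+ G :* P) :* Q) ≋-refl (cst a) G (compose P G) (compose Q G) ⟩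
    (cst a +ₚ G *ₚ compose P G) *ₚ compose Q G
      ∎
    where open ≋-Reasoning

  compose-cst : ∀ c G → compose (cst c) G ≋ cst c
  compose-cst c G = ≋-trans (+ₚ-cong (≋-refl {cst c}) (*ₚ-zeroʳ G)) (+ₚ-identityʳ (cst c))

  compose-assoc : ∀ P G H → compose (compose P G) H ≋ compose P (compose G H)
  compose-assoc []       G H = ≋-refl
  compose-assoc (c ∷ cs) G H = begin
    compose (cst c +ₚ G *ₚ compose cs G) H
      ≈⟨ compose-+ₚ (cst c) (G *ₚ compose cs G) H ⟩
    compose (cst c) H +ₚ compose (G *ₚ compose cs G) H
      ≈⟨ +ₚ-cong (compose-cst c H) (compose-*ₚ G (compose cs G) H) ⟩
    cst c +ₚ compose G H *ₚ compose (compose cs G) H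
      ≈⟨ +ₚ-cong (≋-refl {cst c}) (*ₚ-cong (≋-refl {compose G H}) (compose-assoc cs G H)) ⟩
    cst c +ₚ compose G H *ₚ compose cs (compose G H)
      ∎
    where open ≋-Reasoning

  compose-Xₚ : ∀ P → compose P Xₚ ≋ P
  compose-Xₚ []       = ≋-refl
  compose-Xₚ (c ∷ cs) = ≋-trans (+ₚ-cong (≋-refl {cst c}) (*ₚ-cong (≋-refl {Xₚ}) (compose-Xₚ cs))) (≋-sym (∷-≋ c cs))

  lin-cong : ∀ {u u' v v'} → u ≈ u' → v ≈ v' → lin u v ≋ lin u' v'
  lin-cong u≈u' v≈v' = ∷-cong v≈v' (∷-cong u≈u' ≋-refl)

  compose-lin : ∀ u v G → compose (lin u v) G ≋ cst v +ₚ G *ₚ cst u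
  compose-lin u v G = +ₚ-cong (≋-refl {cst v}) (*ₚ-cong (≋-refl {G}) (compose-cst u G))

  lin-identity : ∀ u v → lin u v ≋ cst v +ₚ Xₚ *ₚ cst u
  lin-identity u v = ∷-≋ v (u ∷ [])

  lin∘lin : ∀ u v c d → compose (lin u v) (lin c d) ≋ lin (u * c) (u * d + v)
  lin∘lin u v c d = begin
    compose (lin u v) (lin c d)                       ≈⟨ compose-lin u v (lin c d) ⟩
    cst v +ₚ lin c d *ₚ cst u                         ≈⟨ +ₚ-cong (≋-refl {cst v}) (*ₚ-cong (lin-identity c d) (≋-refl {cst u})) ⟩
    cst v +ₚ (cst d +ₚ Xₚ *ₚ cst c) *ₚ cst u
      ≈⟨ solve 5 (λ B D X C A → B :+ (D :+ X :* C) :* A := (B :+ D :* A) :+ X :* (C :* A)) ≋-refl (cst v) (cst d) Xₚ (cst c) (cst u) ⟩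
    (cst v +ₚ cst d *ₚ cst u) +ₚ Xₚ *ₚ (cst c *ₚ cst u)
      ≈⟨ +ₚ-cong (+ₚ-cong (≋-refl {cst v}) (cst-*ₚ d u)) (*ₚ-cong (≋-refl {Xₚ}) (cst-*ₚ c u)) ⟩
    cst (v + d * u) +ₚ Xₚ *ₚ cst (c * u)
      ≈⟨ +ₚ-cong (cst-cong (≈-reflexive (swap u v d))) (*ₚ-cong (≋-refl {Xₚ}) (cst-cong (≈-reflexive (ℤP.*-comm c u)))) ⟩
    cst (u * d + v) +ₚ Xₚ *ₚ cst (u * c)              ≈⟨ lin-identity (u * c) (u * d + v) ⟨
    lin (u * c) (u * d + v)                           ∎
    where
    open ≋-Reasoning
    swap : ∀ u v d → v + d * u ≡ u * d + v
    swap = solve-∀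

  compose-lin-lin : ∀ P u v c d → compose (compose P (lin u v)) (lin c d) ≋ compose P (lin (u * c) (u * d + v))
  compose-lin-lin P u v c d = ≋-trans (compose-assoc P (lin u v) (lin c d)) (compose-congʳ P (lin∘lin u v c d))

  shift : ℤ → Poly
  shift e = lin (+ 1) e

  ∣ₚ-compose : ∀ {G F} K → G ∣ₚ F → compose G K ∣ₚ compose F K
  ∣ₚ-compose {G} {F} K (divides Q GQ≋F) =
    divides (compose Q K) (≋-trans (≋-sym (compose-*ₚ G Q K)) (compose-congˡ K GQ≋F))

  compose-lin-inverse : ∀ P {u v c d} → u * c ≈ + 1 → u * d + v ≈ + 0 → compose (compose P (lin u v)) (lin c d) ≋ P
  compose-lin-inverse P {u} {v} {c} {d} uc≈1 ud+v≈0 =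
    ≋-trans (compose-lin-lin P u v c d) (≋-trans (compose-congʳ P (lin-cong uc≈1 ud+v≈0)) (compose-Xₚ P))

  record LinearInverse (a b : ℤ) : Set where
    field
      c d  : ℤ
      undo : ∀ P → compose (compose P (lin a b)) (lin c d) ≋ P
      redo : ∀ P → compose (compose P (lin c d)) (lin a b) ≋ P

  linear-inverse : ∀ {a} b → ¬ a ≈ + 0 → LinearInverse a b
  linear-inverse {a} b a≉0 = record
    { c = c ; d = - (c * b)
    ; undo = λ P → compose-lin-inverse P ac≈1 ad+b≈0
    ; redo = λ P → compose-lin-inverse P (≈-trans (≈-reflexive (ℤP.*-comm c a)) ac≈1) (≈-reflexive (cancel c b)) }
    where
    c : ℤ
    c = proj₁ (inverse a a≉0)
    ac≈1 : a * c ≈ + 1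
    ac≈1 = proj₂ (inverse a a≉0)
    cancel : ∀ c b → c * b + - (c * b) ≡ + 0
    cancel = solve-∀
    expand : ∀ a c b → a * - (c * b) + b ≡ b - (a * c) * b
    expand = solve-∀
    ad+b≈0 : a * - (c * b) + b ≈ + 0
    ad+b≈0 = begin
      a * - (c * b) + b    ≡⟨ expand a c b ⟩
      b - (a * c) * b      ≈⟨ +-cong (≈-refl {b}) (-‿cong (*-cong ac≈1 (≈-refl {b}))) ⟩
      b - + 1 * b          ≡⟨ cong (λ z → b - z) (ℤP.*-identityˡ b) ⟩
      b - b                ≡⟨ ℤP.+-inverseʳ b ⟩
      + 0                  ∎
      where open ≈-Reasoning

  module _ {a} (b : ℤ) (a≉0 : ¬ a ≈ + 0) where
    private
      open LinearInverse (linear-inverse b a≉0)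
      L⁻¹ : Poly
      L⁻¹ = lin c d

    ∣ₚ-compose-lin⁻¹ : ∀ {G F} → compose G (lin a b) ∣ₚ compose F (lin a b) → G ∣ₚ F
    ∣ₚ-compose-lin⁻¹ {G} {F} GL∣FL = ∣ₚ-respˡ (undo G) (∣ₚ-respʳ (undo F) (∣ₚ-compose L⁻¹ GL∣FL))

    compose-lin-zero⁻¹ : ∀ {P} → IsZero (compose P (lin a b)) → IsZero P
    compose-lin-zero⁻¹ {P} PL≋0 = ≋-trans (≋-sym (undo P)) (compose-zero L⁻¹ PL≋0)

    compose-lin-prime : ∀ {P} → IsPrimeₚ P → IsPrimeₚ (compose P (lin a b))
    compose-lin-prime {P} P-prime {U} {V} PL∣UV =
      Sum.map (pull-back U) (pull-back V) (P-prime (∣ₚ-respʳ (compose-*ₚ U V L⁻¹) P∣[UV]L⁻¹))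
      where
      P∣[UV]L⁻¹ : P ∣ₚ compose (U *ₚ V) L⁻¹
      P∣[UV]L⁻¹ = ∣ₚ-respˡ (undo P) (∣ₚ-compose L⁻¹ PL∣UV)
      pull-back : ∀ W → P ∣ₚ compose W L⁻¹ → compose P (lin a b) ∣ₚ W
      pull-back W P∣WL⁻¹ = ∣ₚ-respʳ (redo W) (∣ₚ-compose (lin a b) P∣WL⁻¹)

    compose-lin-nonunit : ∀ {P} → ¬ P ∣ₚ oneₚ → ¬ compose P (lin a b) ∣ₚ oneₚ
    compose-lin-nonunit {P} P∤1 PL∣1 = P∤1 (∣ₚ-respʳ (compose-cst (+ 1) L⁻¹) (∣ₚ-respˡ (undo P) (∣ₚ-compose L⁻¹ PL∣1)))

  coeff-compose-shift-zero : ∀ c cs e → coeff (compose (c ∷ cs) (shift e)) 0 ≡ c + e * coeff (compose cs (shift e)) 0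
  coeff-compose-shift-zero c cs e = trans (coeff-+ₚ (cst c) (shift e *ₚ R) 0) (cong (_+_ c) (coeff-*ₚ (shift e) R 0))
    where R = compose cs (shift e)

  coeff-compose-shift-suc : ∀ c cs e k → coeff (compose (c ∷ cs) (shift e)) (suc k) ≡ e * coeff (compose cs (shift e)) (suc k) + coeff (compose cs (shift e)) k
  coeff-compose-shift-suc c cs e k = begin
    coeff (cst c +ₚ shift e *ₚ R) (suc k)              ≡⟨ coeff-+ₚ (cst c) (shift e *ₚ R) (suc k) ⟩
    + 0 + coeff (shift e *ₚ R) (suc k)                 ≡⟨ ℤP.+-identityˡ _ ⟩
    coeff (shift e *ₚ R) (suc k)                       ≡⟨ coeff-*ₚ (shift e) R (suc k) ⟩
    e * coeff R (suc k) + conv (coeff oneₚ) (coeff R) k   ≡⟨ cong (_+_ (e * coeff R (suc k))) (conv-oneˡ (coeff R) k) ⟩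
    e * coeff R (suc k) + coeff R k                ∎
    where
    open ≡-Reasoning
    R : Poly
    R = compose cs (shift e)

  compose-shift-top : ∀ P e n → VanishesAbove (coeff P) n →
                  VanishesAbove (coeff (compose P (shift e))) n × coeff (compose P (shift e)) n ≈ coeff P n
  compose-shift-top []       e n       _     = (λ _ _ → ≈-refl) , ≈-refl
  compose-shift-top (c ∷ cs) e zero    above = above' , top'
    where
    R≋0 : IsZero (compose cs (shift e))
    R≋0 = compose-zero {cs} (shift e) (mk≋ λ k → above (suc k) (s≤s z≤n))
    above' : VanishesAbove (coeff (compose (c ∷ cs) (shift e))) 0
    above' (suc k) _ = ≈-trans (≈-reflexive (coeff-compose-shift-suc c cs e k))
                               (+-cong (*-≈0ʳ e (coeff-≈ R≋0 (suc k))) (coeff-≈ R≋0 k))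
    top' : coeff (compose (c ∷ cs) (shift e)) 0 ≈ c
    top' = ≈-trans (≈-reflexive (coeff-compose-shift-zero c cs e))
                   (≈-trans (+-cong (≈-refl {c}) (*-≈0ʳ e (coeff-≈ R≋0 0))) (≈-reflexive (ℤP.+-identityʳ c)))
  compose-shift-top (c ∷ cs) e (suc n) above = above' , top'
    where
    ih : VanishesAbove (coeff (compose cs (shift e))) n × coeff (compose cs (shift e)) n ≈ coeff cs n
    ih = compose-shift-top cs e n (λ k n<k → above (suc k) (s≤s n<k))
    above' : VanishesAbove (coeff (compose (c ∷ cs) (shift e))) (suc n)
    above' (suc k) (s≤s n<k) = ≈-trans (≈-reflexive (coeff-compose-shift-suc c cs e k))
      (+-cong (*-≈0ʳ e (proj₁ ih (suc k) (ℕP.m<n⇒m<1+n n<k))) (proj₁ ih k n<k))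
    top' : coeff (compose (c ∷ cs) (shift e)) (suc n) ≈ coeff cs n
    top' = ≈-trans (≈-reflexive (coeff-compose-shift-suc c cs e n))
      (≈-trans (+-cong (*-≈0ʳ e (proj₁ ih (suc n) (ℕP.n<1+n n))) (proj₂ ih)) (≈-reflexive (ℤP.+-identityˡ (coeff cs n))))

  compose-shift-subleading : ∀ P e m → VanishesAbove (coeff P) (suc m) →
                         coeff (compose P (shift e)) m ≈ coeff P m + + suc m * e * coeff P (suc m)
  compose-shift-subleading []       e m       _     = ≈-reflexive (sym (vanish (+ suc m) e))
    where
    vanish : ∀ n e → + 0 + n * e * + 0 ≡ + 0
    vanish = solve-∀
  compose-shift-subleading (c ∷ cs) e zero    above = begin
    coeff (compose (c ∷ cs) (shift e)) 0            ≡⟨ coeff-compose-shift-zero c cs e ⟩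
    c + e * coeff (compose cs (shift e)) 0          ≈⟨ +-cong (≈-refl {c}) (*-cong (≈-refl {e}) (proj₂ (compose-shift-top cs e 0 above-cs))) ⟩
    c + e * coeff cs 0                          ≡⟨ one-times c e (coeff cs 0) ⟩
    c + + 1 * e * coeff cs 0                    ∎
    where
    open ≈-Reasoning
    above-cs : VanishesAbove (coeff cs) 0
    above-cs k 0<k = above (suc k) (s≤s 0<k)
    one-times : ∀ c e x → c + e * x ≡ c + + 1 * e * x
    one-times = solve-∀
  compose-shift-subleading (c ∷ cs) e (suc m) above = begin
    coeff (compose (c ∷ cs) (shift e)) (suc m)
      ≡⟨ coeff-compose-shift-suc c cs e m ⟩
    e * coeff (compose cs (shift e)) (suc m) + coeff (compose cs (shift e)) m
      ≈⟨ +-cong (*-cong (≈-refl {e}) (proj₂ (compose-shift-top cs e (suc m) above-cs)))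
                (compose-shift-subleading cs e m above-cs) ⟩
    e * coeff cs (suc m) + (coeff cs m + + suc m * e * coeff cs (suc m))
      ≡⟨ collect e (coeff cs (suc m)) (coeff cs m) (+ suc m) ⟩
    coeff cs m + (+ 1 + + suc m) * e * coeff cs (suc m)
      ∎
    where
    open ≈-Reasoning
    above-cs : VanishesAbove (coeff cs) (suc m)
    above-cs k m<k = above (suc k) (s≤s m<k)
    collect : ∀ e x y n → e * x + (y + n * e * x) ≡ y + (+ 1 + n) * e * x
    collect = solve-∀

  HasDeg-compose-shift : ∀ {P n} e → HasDeg P n → HasDeg (compose P (shift e)) n
  HasDeg-compose-shift {P} {n} e P°n = mkDeg
    (λ top≈0 → leading≉0 P°n (≈-trans (≈-sym (proj₂ shifted)) top≈0)) (proj₁ shifted)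
    where shifted = compose-shift-top P e n (vanishes-above P°n)

  -- If P(X + e) = u·P then comparing the two top coefficients gives u = 1 and n·e·(leading coefficient) = 0.
  ∤-compose-shift : ∀ {P n e} → HasDeg P n → 1 ℕ.≤ n → n ℕ.< p → ¬ e ≈ + 0 → ¬ P ∣ₚ compose P (shift e)
  ∤-compose-shift {P} {suc m} {e} P°n _ n<p e≉0 (divides U PU≋Pe) =
    *-≉0 (*-≉0 (1≤n<p⇒≉0 (s≤s z≤n) n<p) e≉0) (leading≉0 P°n) n·e·lead≈0
    where
    n : ℕ
    n = suc m
    u : ℤ
    u = coeff U 0
    U≋u : U ≋ cst u
    U≋u = HasDeg-0⇒cst (cofactor-deg-0 PU≋Pe P°n (HasDeg-compose-shift e P°n))
    u·coeff : ∀ k → u * coeff P k ≈ coeff (compose P (shift e)) k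
    u·coeff k = begin
      u * coeff P k            ≡⟨ coeff-map u P k ⟨
      coeff (map (u *_) P) k   ≈⟨ coeff-≈ (map-*≋cst-*ₚ u P) k ⟩
      coeff (cst u *ₚ P) k     ≈⟨ coeff-≈ (*ₚ-comm (cst u) P) k ⟩
      coeff (P *ₚ cst u) k     ≈⟨ coeff-≈ (*ₚ-cong (≋-refl {P}) (≋-sym U≋u)) k ⟩
      coeff (P *ₚ U) k         ≈⟨ coeff-≈ PU≋Pe k ⟩
      coeff (compose P (shift e)) k ∎
      where open ≈-Reasoning
    u≈1 : u ≈ + 1
    u≈1 = *-cancelˡ (leading≉0 P°n) (begin
      coeff P n * u            ≡⟨ ℤP.*-comm (coeff P n) u ⟩
      u * coeff P n            ≈⟨ u·coeff n ⟩
      coeff (compose P (shift e)) n ≈⟨ proj₂ (compose-shift-top P e n (vanishes-above P°n)) ⟩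
      coeff P n                ≡⟨ ℤP.*-identityʳ (coeff P n) ⟨
      coeff P n * + 1          ∎)
      where open ≈-Reasoning
    n·e·lead≈0 : + n * e * coeff P n ≈ + 0
    n·e·lead≈0 = +-cancelˡ (coeff P m) (begin
      coeff P m + + n * e * coeff P n  ≈⟨ compose-shift-subleading P e m (vanishes-above P°n) ⟨
      coeff (compose P (shift e)) m        ≈⟨ u·coeff m ⟨
      u * coeff P m                    ≈⟨ *-cong u≈1 (≈-refl {coeff P m}) ⟩
      + 1 * coeff P m                  ≡⟨ ℤP.*-identityˡ (coeff P m) ⟩
      coeff P m                        ≡⟨ ℤP.+-identityʳ (coeff P m) ⟨
      coeff P m + + 0                  ∎)
      where open ≈-Reasoning

  *ₚ-left-comm : ∀ F Q R → F *ₚ (Q *ₚ R) ≋ Q *ₚ (F *ₚ R)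
  *ₚ-left-comm = solve 3 (λ F Q R → F :* (Q :* R) := Q :* (F :* R)) ≋-refl

  square-of-multiple : ∀ Q A → (Q *ₚ A) *ₚ (Q *ₚ A) ≋ Q *ₚ (Q *ₚ (A *ₚ A))
  square-of-multiple = solve 2 (λ Q A → (Q :* A) :* (Q :* A) := Q :* (Q :* (A :* A))) ≋-refl

  square-of-multiple' : ∀ Q R B → Q *ₚ ((Q *ₚ R) *ₚ (B *ₚ B)) ≋ R *ₚ ((Q *ₚ B) *ₚ (Q *ₚ B))
  square-of-multiple' = solve 3 (λ Q R B → Q :* ((Q :* R) :* (B :* B)) := R :* ((Q :* B) :* (Q :* B))) ≋-refl

  prime-∤-*ₚ : ∀ {Q A B} → IsPrimeₚ Q → ¬ Q ∣ₚ A → ¬ Q ∣ₚ B → ¬ Q ∣ₚ A *ₚ B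
  prime-∤-*ₚ Q-prime Q∤A Q∤B Q∣AB = [ Q∤A , Q∤B ]′ (Q-prime Q∣AB)

  prime-∣-square : ∀ {Q A} → IsPrimeₚ Q → Q ∣ₚ A *ₚ A → Q ∣ₚ A
  prime-∣-square Q-prime Q∣AA = Sum.reduce (Q-prime Q∣AA)

  ∤-prodFin : ∀ {Q} → IsPrimeₚ Q → ¬ Q ∣ₚ oneₚ → ∀ n (f : Fin n → Poly) → (∀ j → ¬ Q ∣ₚ f j) → ¬ Q ∣ₚ prodFin n f
  ∤-prodFin Q-prime Q∤1 zero    f Q∤f = Q∤1
  ∤-prodFin Q-prime Q∤1 (suc n) f Q∤f =
    prime-∤-*ₚ Q-prime (Q∤f fzero) (∤-prodFin Q-prime Q∤1 n (λ j → f (fsuc j)) (λ j → Q∤f (fsuc j)))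

  prodFin-simple-factor : ∀ {Q} → IsPrimeₚ Q → ¬ Q ∣ₚ oneₚ → ∀ n (f : Fin n → Poly) (j* : Fin n) {R₀} →
                          (∀ j → j ≢ j* → ¬ Q ∣ₚ f j) → f j* ≋ Q *ₚ R₀ → ¬ Q ∣ₚ R₀ →
                          ∃ λ R → prodFin n f ≋ Q *ₚ R × ¬ Q ∣ₚ R
  prodFin-simple-factor {Q} Q-prime Q∤1 (suc n) f fzero {R₀} Q∤f f₀≋QR₀ Q∤R₀ =
    R₀ *ₚ rest , ≋-trans (*ₚ-cong f₀≋QR₀ (≋-refl {rest})) (*ₚ-assoc Q R₀ rest)
               , prime-∤-*ₚ Q-prime Q∤R₀ (∤-prodFin Q-prime Q∤1 n (λ j → f (fsuc j)) (λ j → Q∤f (fsuc j) (λ ())))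
    where
    rest : Poly
    rest = prodFin n (λ j → f (fsuc j))
  prodFin-simple-factor {Q} Q-prime Q∤1 (suc n) f (fsuc j*) Q∤f f*≋QR₀ Q∤R₀
    with prodFin-simple-factor Q-prime Q∤1 n (λ j → f (fsuc j)) j*
           (λ j j≢j* → Q∤f (fsuc j) (λ eq → j≢j* (FinP.suc-injective eq))) f*≋QR₀ Q∤R₀
  ... | R , rest≋QR , Q∤R =
    f fzero *ₚ R , ≋-trans (*ₚ-cong (≋-refl {f fzero}) rest≋QR) (*ₚ-left-comm (f fzero) Q R)
                 , prime-∤-*ₚ Q-prime (Q∤f fzero (λ ())) Q∤R

  -- From Q R B² = A² with Q prime and Q ∤ R: Q divides A, hence Q² divides R B², hence Q divides B.
  descent-step : ∀ {Q R A B} → ¬ IsZero Q → IsPrimeₚ Q → ¬ Q ∣ₚ R → (Q *ₚ R) *ₚ (B *ₚ B) ≋ A *ₚ A →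
                 ∃₂ λ A₁ B₁ → Q *ₚ B₁ ≋ B × (Q *ₚ R) *ₚ (B₁ *ₚ B₁) ≋ A₁ *ₚ A₁
  descent-step {Q} {R} {A} {B} Q≉0 Q-prime Q∤R QRB²≋A² =
    step₁ (prime-∣-square Q-prime (divides (R *ₚ (B *ₚ B)) (≋-trans (≋-sym (*ₚ-assoc Q R (B *ₚ B))) QRB²≋A²)))
    where
    step₂ : ∀ {A₁} → R *ₚ (B *ₚ B) ≋ Q *ₚ (A₁ *ₚ A₁) → Q ∣ₚ B → ∃₂ λ A₁ B₁ → Q *ₚ B₁ ≋ B × (Q *ₚ R) *ₚ (B₁ *ₚ B₁) ≋ A₁ *ₚ A₁
    step₂ {A₁} RB²≋QA₁² (divides B₁ QB₁≋B) = A₁ , B₁ , QB₁≋B , *ₚ-cancelˡ Q≉0 (begin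
      Q *ₚ ((Q *ₚ R) *ₚ (B₁ *ₚ B₁))      ≈⟨ square-of-multiple' Q R B₁ ⟩
      R *ₚ ((Q *ₚ B₁) *ₚ (Q *ₚ B₁))      ≈⟨ *ₚ-cong (≋-refl {R}) (*ₚ-cong QB₁≋B QB₁≋B) ⟩
      R *ₚ (B *ₚ B)                      ≈⟨ RB²≋QA₁² ⟩
      Q *ₚ (A₁ *ₚ A₁)                    ∎)
      where open ≋-Reasoning
    step₁ : Q ∣ₚ A → ∃₂ λ A₁ B₁ → Q *ₚ B₁ ≋ B × (Q *ₚ R) *ₚ (B₁ *ₚ B₁) ≋ A₁ *ₚ A₁
    step₁ (divides A₁ QA₁≋A) = step₂ {A₁} RB²≋QA₁²
      ([ (λ Q∣R → ⊥-elim (Q∤R Q∣R)) , prime-∣-square Q-prime ]′ (Q-prime (divides (A₁ *ₚ A₁) (≋-sym RB²≋QA₁²))))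
      where
      open ≋-Reasoning
      RB²≋QA₁² : R *ₚ (B *ₚ B) ≋ Q *ₚ (A₁ *ₚ A₁)
      RB²≋QA₁² = *ₚ-cancelˡ Q≉0 (begin
        Q *ₚ (R *ₚ (B *ₚ B))               ≈⟨ *ₚ-assoc Q R (B *ₚ B) ⟨
        (Q *ₚ R) *ₚ (B *ₚ B)               ≈⟨ QRB²≋A² ⟩
        A *ₚ A                             ≈⟨ *ₚ-cong QA₁≋A QA₁≋A ⟨
        (Q *ₚ A₁) *ₚ (Q *ₚ A₁)             ≈⟨ square-of-multiple Q A₁ ⟩
        Q *ₚ (Q *ₚ (A₁ *ₚ A₁))             ∎)

  not-square-times-square : ∀ {Q R} → ¬ IsZero Q → IsPrimeₚ Q → ¬ Q ∣ₚ R →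
                            ∀ {A B n} → HasDeg B n → ¬ (Q *ₚ R) *ₚ (B *ₚ B) ≋ A *ₚ A
  not-square-times-square {Q} {R} Q≉0 Q-prime Q∤R {A} {B} {n} B°n QRB²≋A² =
    refute-minimal Solution no-least n (A , B , B°n , QRB²≋A²)
    where
    Solution : ℕ → Set
    Solution n = ∃₂ λ A B → HasDeg B n × (Q *ₚ R) *ₚ (B *ₚ B) ≋ A *ₚ A
    no-least : ∀ n → Solution n → (∀ {k} → k ℕ.< n → ¬ Solution k) → ⊥
    no-least n (A , B , B°n , eq) smaller = descend (descent-step {A = A} {B} Q≉0 Q-prime Q∤R eq)
      where
      descend : ∃₂ (λ A₁ B₁ → Q *ₚ B₁ ≋ B × (Q *ₚ R) *ₚ (B₁ *ₚ B₁) ≋ A₁ *ₚ A₁) → ⊥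
      descend (A₁ , B₁ , QB₁≋B , eq₁) = shrink (zero⊎HasDeg B₁) (zero⊎HasDeg Q)
        where
        shrink : IsZero B₁ ⊎ ∃ (HasDeg B₁) → IsZero Q ⊎ ∃ (HasDeg Q) → ⊥
        shrink (inj₁ B₁≋0) _ = HasDeg⇒≉0 B°n (≋-trans (≋-sym QB₁≋B) (≋-trans (*ₚ-cong (≋-refl {Q}) B₁≋0) (*ₚ-zeroʳ Q)))
        shrink (inj₂ _) (inj₁ Q≋0) = Q≉0 Q≋0
        shrink (inj₂ _) (inj₂ (zero , Q°0)) = Q∤R (HasDeg-0-∣ₚ Q°0 R)
        shrink (inj₂ (k , B₁°k)) (inj₂ (suc q , Q°q)) = smaller k<n (A₁ , B₁ , B₁°k , eq₁)
          where
          k<n : k ℕ.< n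
          k<n = subst (k ℕ.<_) (HasDeg-unique (HasDeg-resp QB₁≋B (HasDeg-*ₚ Q°q B₁°k)) B°n) (s≤s (ℕP.m≤n+m k q))

  ℕ-≈-multiple : ∀ {a b} q → a ≡ b ℕ.+ q ℕ.* p → + a ≈ + b
  ℕ-≈-multiple {a} {b} q a≡b+qp = ≈-multiple (+ q)
    (trans (cong +_ a≡b+qp) (trans (ℤP.pos-+ b (q ℕ.* p)) (cong (ℤ._+_ (+ b)) (ℤP.pos-* q p))))

  %-≈ : ∀ m → + (m % p) ≈ + m
  %-≈ m = ≈-sym (ℕ-≈-multiple (m / p) (m≡m%n+[m/n]*n m p))

  +-≈ : ∀ m n → + (m ℕ.+ n) ≈ + m ℤ.+ + n
  +-≈ m n = ≈-reflexive (ℤP.pos-+ m n)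

  fwd-dist : ℕ → ℕ → ℕ
  fwd-dist a b = (b ℕ.+ p ∸ a) % p

  fwd-dist<p : ∀ a b → fwd-dist a b < p
  fwd-dist<p a b = m%n<n (b ℕ.+ p ∸ a) p

  fwd-dist-≈ : ∀ {a} b → a < p → + b ≈ + a ℤ.+ + fwd-dist a b
  fwd-dist-≈ {a} b a<p = ≈-trans (≈-sym b+p≈b) (≈-trans (ℕ-≈-multiple (w / p) b+p≡) (+-≈ a (fwd-dist a b)))
    where
    w : ℕ
    w = b ℕ.+ p ∸ a
    b+p≈b : + (b ℕ.+ p) ≈ + b
    b+p≈b = ℕ-≈-multiple 1 (cong (b ℕ.+_) (sym (ℕP.+-identityʳ p)))
    b+p≡ : b ℕ.+ p ≡ a ℕ.+ fwd-dist a b ℕ.+ (w / p) ℕ.* p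
    b+p≡ = trans (sym (ℕP.m+[n∸m]≡n (ℕP.≤-trans (ℕP.<⇒≤ a<p) (ℕP.m≤n+m p b))))
                 (trans (cong (a ℕ.+_) (m≡m%n+[m/n]*n w p)) (sym (ℕP.+-assoc a (fwd-dist a b) _)))

  fwd-dist-unique : ∀ {a b D} → a < p → D < p → + b ≈ + a ℤ.+ + D → fwd-dist a b ≡ D
  fwd-dist-unique {a} {b} {D} a<p D<p b≈a+D =
    <p-≈⇒≡ (fwd-dist<p a b) D<p (+-cancelˡ (+ a) (≈-trans (≈-sym (fwd-dist-≈ b a<p)) b≈a+D))

  module _ {N : ℕ} (σ : Fin N → ℕ) (σ<p : ∀ i → σ i < p) (g : ℕ) (N*g<p : N ℕ.* g < p) where

    IsolatedAt : Fin N → Set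
    IsolatedAt a = ∀ i → fwd-dist (σ a) (σ i) ≡ 0 ⊎ g ≤ fwd-dist (σ a) (σ i)

    CloseSuccessor : (Fin N → Fin N) → Set
    CloseSuccessor next = ∀ a → 0 < fwd-dist (σ a) (σ (next a)) × fwd-dist (σ a) (σ (next a)) < g

    -- Walking N steps, each to a different point less than g ahead, covers a distance in (0, p)
    -- but, by pigeonhole, returns to a point already visited.
    module Walk {next : Fin N → Fin N} (close : CloseSuccessor next) (a₀ : Fin N) where

      walk : ℕ → Fin N
      walk zero    = a₀
      walk (suc n) = next (walk n)

      step : ℕ → ℕ
      step n = fwd-dist (σ (walk n)) (σ (walk (suc n)))

      pos : ℕ → ℕ
      pos zero    = 0
      pos (suc n) = pos n ℕ.+ step n

      pos-≈ : ∀ n → + σ (walk n) ≈ + σ a₀ ℤ.+ + pos n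
      pos-≈ zero    = ≈-reflexive (sym (ℤP.+-identityʳ (+ σ a₀)))
      pos-≈ (suc n) = begin
        + σ (walk (suc n))                          ≈⟨ fwd-dist-≈ (σ (walk (suc n))) (σ<p (walk n)) ⟩
        + σ (walk n) ℤ.+ + step n                   ≈⟨ +-cong (pos-≈ n) (≈-refl {+ step n}) ⟩
        (+ σ a₀ ℤ.+ + pos n) ℤ.+ + step n          ≡⟨ ℤP.+-assoc (+ σ a₀) (+ pos n) (+ step n) ⟩
        + σ a₀ ℤ.+ (+ pos n ℤ.+ + step n)          ≈⟨ +-cong (≈-refl {+ σ a₀}) (≈-sym (+-≈ (pos n) (step n))) ⟩
        + σ a₀ ℤ.+ + pos (suc n)                    ∎
        where open ≈-Reasoning

      pos-≤ : ∀ n → pos n ≤ n ℕ.* g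
      pos-≤ zero    = z≤n
      pos-≤ (suc n) = subst (pos n ℕ.+ step n ≤_) (ℕP.+-comm (n ℕ.* g) g)
                            (ℕP.+-mono-≤ (pos-≤ n) (ℕP.<⇒≤ (proj₂ (close (walk n)))))

      pos-< : ∀ {m n} → m < n → pos m < pos n
      pos-< {m} {suc n} (s≤s m≤n) with ℕP.m≤n⇒m<n∨m≡n m≤n
      ... | inj₁ m<n  = ℕP.<-≤-trans (pos-< m<n) (ℕP.m≤m+n (pos n) (step n))
      ... | inj₂ refl = ℕP.m<m+n (pos m) (proj₁ (close (walk m)))

      pos<p : ∀ {n} → n ≤ N → pos n < p
      pos<p {n} n≤N = ℕP.≤-<-trans (pos-≤ n) (ℕP.≤-<-trans (ℕP.*-monoˡ-≤ g n≤N) N*g<p)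

      revisit : ⊥
      revisit with FinP.pigeonhole (ℕP.n<1+n N) (λ x → walk (toℕ x))
      ... | x , y , x<y , same = ℕP.<-irrefl pos-x≡pos-y (pos-< x<y)
        where
        pos-x≡pos-y : pos (toℕ x) ≡ pos (toℕ y)
        pos-x≡pos-y = <p-≈⇒≡ (pos<p (ℕP.≤-pred (FinP.toℕ<n x))) (pos<p (ℕP.≤-pred (FinP.toℕ<n y)))
          (+-cancelˡ (+ σ a₀) (≈-trans (≈-sym (pos-≈ (toℕ x))) (≈-trans (≈-reflexive (cong (λ z → + σ z) same)) (pos-≈ (toℕ y)))))

    isolated? : ∀ a i → Dec (fwd-dist (σ a) (σ i) ≡ 0 ⊎ g ≤ fwd-dist (σ a) (σ i))
    isolated? a i with fwd-dist (σ a) (σ i) ℕ.≟ 0 | g ℕ.≤? fwd-dist (σ a) (σ i)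
    ... | yes d≡0 | _      = yes (inj₁ d≡0)
    ... | no _    | yes g≤d = yes (inj₂ g≤d)
    ... | no d≢0  | no g≰d  = no λ { (inj₁ d≡0) → d≢0 d≡0 ; (inj₂ g≤d) → g≰d g≤d }

    isolated-point : Fin N → ∃ IsolatedAt
    isolated-point a₀ with FinP.any? (λ a → FinP.all? (isolated? a))
    ... | yes found = found
    ... | no none   = ⊥-elim (Walk.revisit close a₀)
      where
      witness : ∀ a → ∃ λ i → ¬ (fwd-dist (σ a) (σ i) ≡ 0 ⊎ g ≤ fwd-dist (σ a) (σ i))
      witness a = FinP.¬∀⟶∃¬ N _ (isolated? a) (λ all → none (a , all))
      close : CloseSuccessor (λ a → proj₁ (witness a))
      close a = ℕP.n≢0⇒n>0 (λ d≡0 → proj₂ (witness a) (inj₁ d≡0)) , ℕP.≰⇒> (λ g≤d → proj₂ (witness a) (inj₂ g≤d))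

  equal-quotients : ∀ {a b c e} → a / p ≡ b / p → c ℕ.+ a ≡ b ℕ.+ e → c ℕ.+ a % p ≡ b % p ℕ.+ e
  equal-quotients {a} {b} {c} {e} a/p≡b/p c+a≡b+e = ℕP.+-cancelʳ-≡ (a / p ℕ.* p) _ _ (begin
    c ℕ.+ a % p ℕ.+ a / p ℕ.* p        ≡⟨ ℕP.+-assoc c (a % p) _ ⟩
    c ℕ.+ (a % p ℕ.+ a / p ℕ.* p)      ≡⟨ cong (c ℕ.+_) (m≡m%n+[m/n]*n a p) ⟨
    c ℕ.+ a                            ≡⟨ c+a≡b+e ⟩
    b ℕ.+ e                            ≡⟨ cong (ℕ._+ e) (m≡m%n+[m/n]*n b p) ⟩
    b % p ℕ.+ b / p ℕ.* p ℕ.+ e        ≡⟨ cong (λ q → b % p ℕ.+ q ℕ.* p ℕ.+ e) a/p≡b/p ⟨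
    b % p ℕ.+ a / p ℕ.* p ℕ.+ e        ≡⟨ swap (b % p) (a / p ℕ.* p) e ⟩
    b % p ℕ.+ e ℕ.+ a / p ℕ.* p        ∎)
    where
    open ≡-Reasoning
    swap : ∀ x y z → x ℕ.+ y ℕ.+ z ≡ x ℕ.+ z ℕ.+ y
    swap = ℕ-solve-∀

  -- Adding p first avoids truncated subtraction.
  residue-difference : ∀ {τ₁ τ₂} b → τ₁ ≤ τ₂ → + ((τ₂ ℕ.* b) % p ℕ.+ p ∸ (τ₁ ℕ.* b) % p) ≈ + ((τ₂ ∸ τ₁) ℕ.* b)
  residue-difference {τ₁} {τ₂} b τ₁≤τ₂ = +-cancelʳ (+ y₁) (begin
    + V ℤ.+ + y₁                             ≈⟨ ≈-sym (+-≈ V y₁) ⟩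
    + (V ℕ.+ y₁)                             ≡⟨ cong +_ V+y₁ ⟩
    + (y₂ ℕ.+ p)                             ≈⟨ +-≈ y₂ p ⟩
    + y₂ ℤ.+ + p                             ≈⟨ +-cong (%-≈ (τ₂ ℕ.* b)) p≈0 ⟩
    + (τ₂ ℕ.* b) ℤ.+ + 0                     ≡⟨ ℤP.+-identityʳ _ ⟩
    + (τ₂ ℕ.* b)                             ≡⟨ cong (λ z → + (z ℕ.* b)) (ℕP.m∸n+n≡m τ₁≤τ₂) ⟨
    + ((t ℕ.+ τ₁) ℕ.* b)                     ≡⟨ cong +_ (ℕP.*-distribʳ-+ b t τ₁) ⟩
    + (t ℕ.* b ℕ.+ τ₁ ℕ.* b)                 ≈⟨ +-≈ (t ℕ.* b) (τ₁ ℕ.* b) ⟩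
    + (t ℕ.* b) ℤ.+ + (τ₁ ℕ.* b)             ≈⟨ +-cong (≈-refl {+ (t ℕ.* b)}) (≈-sym (%-≈ (τ₁ ℕ.* b))) ⟩
    + (t ℕ.* b) ℤ.+ + y₁                     ∎)
    where
    open ≈-Reasoning
    t : ℕ
    t = τ₂ ∸ τ₁
    y₁ : ℕ
    y₁ = (τ₁ ℕ.* b) % p
    y₂ : ℕ
    y₂ = (τ₂ ℕ.* b) % p
    V : ℕ
    V = y₂ ℕ.+ p ∸ y₁
    V+y₁ : V ℕ.+ y₁ ≡ y₂ ℕ.+ p
    V+y₁ = ℕP.m∸n+n≡m (ℕP.≤-trans (ℕP.<⇒≤ (m%n<n (τ₁ ℕ.* b) p)) (ℕP.m≤n+m p y₂))

  close-residues : ∀ k {y₁ y₂} → y₁ < p → (k ℕ.* y₁) / p ≡ (k ℕ.* y₂) / p →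
                   k ℕ.* (y₂ ℕ.+ p ∸ y₁) < k ℕ.* p ℕ.+ p × k ℕ.* p < k ℕ.* (y₂ ℕ.+ p ∸ y₁) ℕ.+ p
  close-residues k {y₁} {y₂} y₁<p same-quotient = upper , lower
    where
    V : ℕ
    V = y₂ ℕ.+ p ∸ y₁
    kV : k ℕ.* V ℕ.+ (k ℕ.* y₁) % p ≡ (k ℕ.* y₂) % p ℕ.+ k ℕ.* p
    kV = equal-quotients same-quotient (begin
      k ℕ.* V ℕ.+ k ℕ.* y₁     ≡⟨ ℕP.*-distribˡ-+ k V y₁ ⟨
      k ℕ.* (V ℕ.+ y₁)         ≡⟨ cong (k ℕ.*_) (ℕP.m∸n+n≡m (ℕP.≤-trans (ℕP.<⇒≤ y₁<p) (ℕP.m≤n+m p y₂))) ⟩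
      k ℕ.* (y₂ ℕ.+ p)         ≡⟨ ℕP.*-distribˡ-+ k y₂ p ⟩
      k ℕ.* y₂ ℕ.+ k ℕ.* p     ∎)
      where open ≡-Reasoning
    upper : k ℕ.* V < k ℕ.* p ℕ.+ p
    upper = ℕP.≤-<-trans (ℕP.m≤m+n (k ℕ.* V) _)
      (subst (_< k ℕ.* p ℕ.+ p) (sym kV)
        (subst (_< k ℕ.* p ℕ.+ p) (ℕP.+-comm (k ℕ.* p) _) (ℕP.+-monoʳ-< (k ℕ.* p) (m%n<n (k ℕ.* y₂) p))))
    lower : k ℕ.* p < k ℕ.* V ℕ.+ p
    lower = ℕP.≤-<-trans (ℕP.m≤n+m (k ℕ.* p) ((k ℕ.* y₂) % p))
      (subst (_< k ℕ.* V ℕ.+ p) kV (ℕP.+-monoʳ-< (k ℕ.* V) (m%n<n (k ℕ.* y₁) p)))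

  -- V j represents t·β j by an integer within p/k of p, so that no subtraction is needed.
  record SimultaneousApproximation (k L : ℕ) (β : Fin L → ℕ) : Set where
    field
      t       : ℕ
      1≤t     : 1 ≤ t
      t<p     : t < p
      V       : Fin L → ℕ
      V≈tβ    : ∀ j → + V j ≈ + (t ℕ.* β j)
      V-upper : ∀ j → k ℕ.* V j < k ℕ.* p ℕ.+ p
      V-lower : ∀ j → k ℕ.* p < k ℕ.* V j ℕ.+ p

  -- Two of the p multiples τ·β fall into the same of the k^L boxes of side p/k.
  dirichlet : ∀ {k L} .{{_ : NonZero k}} → k ^ L < p → (β : Fin L → ℕ) → SimultaneousApproximation k L β
  dirichlet {k} {L} k^L<p β = from-collision (FinP.pigeonhole k^L<p (λ τ → funToFin (box (toℕ τ))))
    where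
    box : ℕ → Fin L → Fin k
    box τ j = fromℕ< (m<n*o⇒m/o<n (ℕP.*-monoʳ-< k (m%n<n (τ ℕ.* β j) p)))
    from-collision : (∃₂ λ τ₁ τ₂ → τ₁ Fin.< τ₂ × funToFin (box (toℕ τ₁)) ≡ funToFin (box (toℕ τ₂))) →
                     SimultaneousApproximation k L β
    from-collision (τ₁ , τ₂ , τ₁<τ₂ , same-code) = record
      { t = toℕ τ₂ ∸ toℕ τ₁ ; 1≤t = ℕP.m<n⇒0<n∸m τ₁<τ₂ ; t<p = ℕP.≤-<-trans (ℕP.m∸n≤m (toℕ τ₂) (toℕ τ₁)) (FinP.toℕ<n τ₂)
      ; V = λ j → (toℕ τ₂ ℕ.* β j) % p ℕ.+ p ∸ (toℕ τ₁ ℕ.* β j) % p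
      ; V≈tβ = λ j → residue-difference (β j) (ℕP.<⇒≤ τ₁<τ₂)
      ; V-upper = λ j → proj₁ (close-residues k (m%n<n (toℕ τ₁ ℕ.* β j) p) (same-box j))
      ; V-lower = λ j → proj₂ (close-residues k (m%n<n (toℕ τ₁ ℕ.* β j) p) (same-box j)) }
      where
      same-box : ∀ j → (k ℕ.* ((toℕ τ₁ ℕ.* β j) % p)) / p ≡ (k ℕ.* ((toℕ τ₂ ℕ.* β j) % p)) / p
      same-box j = trans (sym (FinP.toℕ-fromℕ< _)) (trans (cong toℕ box-eq) (FinP.toℕ-fromℕ< _))
        where
        box-eq : box (toℕ τ₁) j ≡ box (toℕ τ₂) j
        box-eq = trans (sym (FinP.finToFun-funToFin (box (toℕ τ₁)) j))
                       (trans (cong (λ c → finToFun c j) same-code) (FinP.finToFun-funToFin (box (toℕ τ₂)) j))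

  ≤-^ : ∀ m {n} → 1 ≤ n → m ≤ m ^ n
  ≤-^ zero    _   = z≤n
  ≤-^ (suc m) {n} n≥1 = subst (_≤ suc m ^ n) (ℕP.*-identityʳ (suc m)) (ℕP.^-monoʳ-≤ (suc m) n≥1)

  argmax : ∀ {L} (V : Fin (suc L) → ℕ) → ∃ λ j* → ∀ j → V j ≤ V j*
  argmax {zero}  V = fzero , λ { fzero → ℕP.≤-refl }
  argmax {suc L} V with argmax (λ j → V (fsuc j))
  ... | m , V≤Vm with V fzero ℕ.≤? V (fsuc m)
  ...   | yes V₀≤Vm = fsuc m , λ { fzero → V₀≤Vm ; (fsuc j) → V≤Vm j }
  ...   | no  V₀≰Vm = fzero , λ { fzero → ℕP.≤-refl ; (fsuc j) → ℕP.≤-trans (V≤Vm j) (ℕP.<⇒≤ (ℕP.≰⇒> V₀≰Vm)) }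

  -- Scale by the t of Dirichlet's theorem, so that all t·β j are close to 0; take j* with t·β j* largest
  -- and i* such that no t·s i lies shortly after t·s i*.
  module IsolatedSum {d L' N} (d≥1 : 1 ≤ d) (k^L<p : (4 ℕ.* d) ^ suc L' < p) (N≤d : N ≤ d)
                     (β : Fin (suc L') → ℕ) (β-distinct : ∀ j j' → j ≢ j' → ¬ + β j ≈ + β j')
                     (s : Fin N → ℕ) (i₀ : Fin N) where

    k : ℕ

    k = 4 ℕ.* d

    instance
      k≢0 : NonZero k
      k≢0 = ℕ.>-nonZero (ℕP.≤-trans d≥1 (ℕP.m≤m+n d _))
      2d≢0 : NonZero (2 ℕ.* d)
      2d≢0 = ℕ.>-nonZero (ℕP.≤-trans d≥1 (ℕP.m≤m+n d _))

    2d<p : 2 ℕ.* d < p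
    2d<p = ℕP.≤-<-trans (ℕP.*-monoˡ-≤ d {2} {4} (s≤s (s≤s z≤n))) (ℕP.≤-<-trans (≤-^ k {suc L'} (s≤s z≤n)) k^L<p)

    open SimultaneousApproximation (dirichlet k^L<p β)

    σ : Fin N → ℕ
    σ i = (t ℕ.* s i) % p

    σ<p : ∀ i → σ i < p
    σ<p i = m%n<n (t ℕ.* s i) p

    g : ℕ

    g = p / (2 ℕ.* d) ℕ.+ 1

    p<2dg : p < 2 ℕ.* d ℕ.* g
    p<2dg = begin-strict
      p                                             ≡⟨ m≡m%n+[m/n]*n p (2 ℕ.* d) ⟩
      p % (2 ℕ.* d) ℕ.+ p / (2 ℕ.* d) ℕ.* (2 ℕ.* d) <⟨ ℕP.+-monoˡ-< _ (m%n<n p (2 ℕ.* d)) ⟩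
      2 ℕ.* d ℕ.+ p / (2 ℕ.* d) ℕ.* (2 ℕ.* d)       ≡⟨ fold (2 ℕ.* d) (p / (2 ℕ.* d)) ⟩
      2 ℕ.* d ℕ.* g                                 ∎
      where
      open ℕP.≤-Reasoning
      fold : ∀ a b → a ℕ.+ b ℕ.* a ≡ a ℕ.* (b ℕ.+ 1)
      fold = ℕ-solve-∀

    Ng<p : N ℕ.* g < p
    Ng<p = ℕP.≤-<-trans (ℕP.*-monoˡ-≤ g N≤d) (ℕP.*-cancelˡ-< 2 _ _ (begin-strict
      2 ℕ.* (d ℕ.* g)                           ≡⟨ unfold d (p / (2 ℕ.* d)) ⟩
      p / (2 ℕ.* d) ℕ.* (2 ℕ.* d) ℕ.+ 2 ℕ.* d   ≤⟨ ℕP.+-monoˡ-≤ (2 ℕ.* d) (m/n*n≤m p (2 ℕ.* d)) ⟩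
      p ℕ.+ 2 ℕ.* d                             <⟨ ℕP.+-monoʳ-< p 2d<p ⟩
      p ℕ.+ p                                   ≡⟨ double p ⟩
      2 ℕ.* p                                   ∎))
      where
      open ℕP.≤-Reasoning
      unfold : ∀ d q → 2 ℕ.* (d ℕ.* (q ℕ.+ 1)) ≡ q ℕ.* (2 ℕ.* d) ℕ.+ 2 ℕ.* d
      unfold = ℕ-solve-∀
      double : ∀ p → p ℕ.+ p ≡ 2 ℕ.* p
      double = ℕ-solve-∀

    i* : Fin N
    i* = proj₁ (isolated-point σ σ<p g Ng<p i₀)

    j* : Fin (suc L')
    j* = proj₁ (argmax V)

    scaled : ∀ i j → + σ i ℤ.+ + V j ≈ + t ℤ.* + (s i ℕ.+ β j)
    scaled i j = begin
      + σ i ℤ.+ + V j                      ≈⟨ +-cong (%-≈ (t ℕ.* s i)) (V≈tβ j) ⟩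
      + (t ℕ.* s i) ℤ.+ + (t ℕ.* β j)      ≈⟨ +-≈ (t ℕ.* s i) (t ℕ.* β j) ⟨
      + (t ℕ.* s i ℕ.+ t ℕ.* β j)          ≡⟨ cong +_ (ℕP.*-distribˡ-+ t (s i) (β j)) ⟨
      + (t ℕ.* (s i ℕ.+ β j))              ≡⟨ ℤP.pos-* t (s i ℕ.+ β j) ⟩
      + t ℤ.* + (s i ℕ.+ β j)              ∎
      where open ≈-Reasoning

    -- In the scaled picture, t·s i lies D := V j* - V j ahead of t·s i*, with D < p/2d < g.
    module _ {i j} (sum≈ : + (s i ℕ.+ β j) ≈ + (s i* ℕ.+ β j*)) where

      D : ℕ

      D = V j* ∸ V j

      Vj*≡D+Vj : V j* ≡ D ℕ.+ V j
      Vj*≡D+Vj = sym (ℕP.m∸n+n≡m (proj₂ (argmax V) j))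

      σ-shift : + σ i ≈ + σ i* ℤ.+ + D
      σ-shift = +-cancelʳ (+ V j) (begin
        + σ i ℤ.+ + V j                      ≈⟨ scaled i j ⟩
        + t ℤ.* + (s i ℕ.+ β j)              ≈⟨ *-cong (≈-refl {+ t}) sum≈ ⟩
        + t ℤ.* + (s i* ℕ.+ β j*)            ≈⟨ scaled i* j* ⟨
        + σ i* ℤ.+ + V j*                    ≡⟨ cong (λ v → + σ i* ℤ.+ + v) Vj*≡D+Vj ⟩
        + σ i* ℤ.+ + (D ℕ.+ V j)             ≈⟨ +-cong (≈-refl {+ σ i*}) (+-≈ D (V j)) ⟩
        + σ i* ℤ.+ (+ D ℤ.+ + V j)           ≡⟨ ℤP.+-assoc (+ σ i*) (+ D) (+ V j) ⟨
        + σ i* ℤ.+ + D ℤ.+ + V j             ∎)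
        where open ≈-Reasoning

      kD<2p : k ℕ.* D < 2 ℕ.* p
      kD<2p = ℕP.+-cancelʳ-< (k ℕ.* V j) (k ℕ.* D) (2 ℕ.* p) (begin-strict
        k ℕ.* D ℕ.+ k ℕ.* V j        ≡⟨ ℕP.*-distribˡ-+ k D (V j) ⟨
        k ℕ.* (D ℕ.+ V j)            ≡⟨ cong (k ℕ.*_) Vj*≡D+Vj ⟨
        k ℕ.* V j*                   <⟨ V-upper j* ⟩
        k ℕ.* p ℕ.+ p                <⟨ ℕP.+-monoˡ-< p (V-lower j) ⟩
        k ℕ.* V j ℕ.+ p ℕ.+ p        ≡⟨ regroup (k ℕ.* V j) p ⟩
        2 ℕ.* p ℕ.+ k ℕ.* V j        ∎)
        where
        open ℕP.≤-Reasoning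
        regroup : ∀ a p → a ℕ.+ p ℕ.+ p ≡ 2 ℕ.* p ℕ.+ a
        regroup = ℕ-solve-∀

      fwd≡D : fwd-dist (σ i*) (σ i) ≡ D
      fwd≡D = fwd-dist-unique (σ<p i*) D<p σ-shift
        where
        2≤k : 2 ≤ k
        2≤k = ℕP.≤-trans (s≤s (s≤s z≤n)) (ℕP.*-monoʳ-≤ 4 d≥1)
        D<p : D < p
        D<p = ℕP.*-cancelˡ-< 2 D p (ℕP.≤-<-trans (ℕP.*-monoˡ-≤ D 2≤k) kD<2p)

      g≰D : ¬ g ≤ D
      g≰D g≤D = ℕP.<-asym kD<2p (begin-strict
        2 ℕ.* p                 <⟨ ℕP.*-monoʳ-< 2 p<2dg ⟩
        2 ℕ.* (2 ℕ.* d ℕ.* g)   ≡⟨ regroup d g ⟩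
        k ℕ.* g                 ≤⟨ ℕP.*-monoʳ-≤ k g≤D ⟩
        k ℕ.* D                 ∎)
        where
        open ℕP.≤-Reasoning
        regroup : ∀ d g → 2 ℕ.* (2 ℕ.* d ℕ.* g) ≡ 4 ℕ.* d ℕ.* g
        regroup = ℕ-solve-∀

      D≡0⇒j≡j* : D ≡ 0 → j ≡ j*
      D≡0⇒j≡j* D≡0 = decidable-stable (j Fin.≟ j*) (λ j≢j* → β-distinct j j* j≢j* βj≈βj*)
        where
        βj≈βj* : + β j ≈ + β j*
        βj≈βj* = *-cancelˡ (1≤n<p⇒≉0 1≤t t<p) (begin
          + t ℤ.* + β j           ≡⟨ ℤP.pos-* t (β j) ⟨
          + (t ℕ.* β j)           ≈⟨ V≈tβ j ⟨
          + V j                   ≡⟨ cong +_ (trans Vj*≡D+Vj (cong (ℕ._+ V j) D≡0)) ⟨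
          + V j*                  ≈⟨ V≈tβ j* ⟩
          + (t ℕ.* β j*)          ≡⟨ ℤP.pos-* t (β j*) ⟩
          + t ℤ.* + β j*          ∎)
          where open ≈-Reasoning

      j≡j* : j ≡ j*
      j≡j* = [ (λ fwd≡0 → D≡0⇒j≡j* (trans (sym fwd≡D) fwd≡0)) , (λ g≤fwd → ⊥-elim (g≰D (subst (g ≤_) fwd≡D g≤fwd))) ]′
               (proj₂ (isolated-point σ σ<p g Ng<p i₀) i)

  isolated-sum : ∀ {d L N} → 1 ≤ d → 1 ≤ L → (4 ℕ.* d) ^ L < p → N ≤ d →
                 (β : Fin L → ℕ) → (∀ j j' → j ≢ j' → ¬ + β j ≈ + β j') → (s : Fin N → ℕ) → Fin N →
                 ∃₂ λ i* j* → ∀ i j → + (s i ℕ.+ β j) ≈ + (s i* ℕ.+ β j*) → j ≡ j*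
  isolated-sum {L = suc L'} d≥1 _ k^L<p N≤d β β-distinct s i₀ = i* , j* , λ i j → j≡j* {i} {j}
    where open IsolatedSum d≥1 k^L<p N≤d β β-distinct s i₀

  HasDeg-prodFin : ∀ {m} N (f : Fin N → Poly) → (∀ i → HasDeg (f i) m) → HasDeg (prodFin N f) (N ℕ.* m)
  HasDeg-prodFin zero    f f°m = oneₚ-deg
  HasDeg-prodFin (suc N) f f°m = HasDeg-*ₚ (f°m fzero) (HasDeg-prodFin N (λ i → f (fsuc i)) (λ i → f°m (fsuc i)))

  prodFin-∣ₚ : ∀ {F} N (f : Fin N → Poly) → (∀ i → IsPrimeₚ (f i)) → (∀ i → ¬ f i ∣ₚ oneₚ) →
               (∀ i i' → i ≢ i' → ¬ f i ∣ₚ f i') → (∀ i → f i ∣ₚ F) → prodFin N f ∣ₚ F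
  prodFin-∣ₚ {F} zero    f _     _       _        _   = divides F (*ₚ-identityˡ F)
  prodFin-∣ₚ {F} (suc N) f prime nonunit distinct f∣F with prodFin-∣ₚ N (λ i → f (fsuc i)) (λ i → prime (fsuc i))
    (λ i → nonunit (fsuc i)) (λ i i' i≢i' → distinct (fsuc i) (fsuc i') (λ eq → i≢i' (FinP.suc-injective eq))) (λ i → f∣F (fsuc i))
  ... | divides G rest·G≋F with prime fzero (∣ₚ-respʳ (≋-sym rest·G≋F) (f∣F fzero))
  ...   | inj₁ f₀∣rest = ⊥-elim (∤-prodFin (prime fzero) (nonunit fzero) N (λ i → f (fsuc i))
                                  (λ i → distinct fzero (fsuc i) (λ ())) f₀∣rest)
  ...   | inj₂ (divides G' f₀G'≋G) = divides G' (begin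
    (f fzero *ₚ rest) *ₚ G'     ≈⟨ *ₚ-assoc (f fzero) rest G' ⟩
    f fzero *ₚ (rest *ₚ G')     ≈⟨ *ₚ-left-comm (f fzero) rest G' ⟩
    rest *ₚ (f fzero *ₚ G')     ≈⟨ *ₚ-cong (≋-refl {rest}) f₀G'≋G ⟩
    rest *ₚ G                   ≈⟨ rest·G≋F ⟩
    F                           ∎)
    where
    open ≋-Reasoning
    rest : Poly
    rest = prodFin N (λ i → f (fsuc i))

  compose-shift-lin : ∀ P {e a b c} → b + e ≈ c → compose (compose P (shift e)) (lin a b) ≋ compose P (lin a c)
  compose-shift-lin P {e} {a} {b} b+e≈c = ≋-trans (compose-lin-lin P (+ 1) e a b)
    (compose-congʳ P (lin-cong (≈-reflexive (ℤP.*-identityˡ a)) (≈-trans (≈-reflexive (cong (_+ e) (ℤP.*-identityˡ b))) b+e≈c)))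

  1≉0 : ¬ + 1 ≈ + 0
  1≉0 = 1≤n<p⇒≉0 (s≤s z≤n) 1<p

  compose-shift-prime : ∀ {P} e → Irreducible P → IsPrimeₚ (compose P (shift e))
  compose-shift-prime e P-irr = compose-lin-prime e 1≉0 (irreducible⇒prime P-irr)

  compose-shift-nonunit : ∀ {P} e → Irreducible P → ¬ compose P (shift e) ∣ₚ oneₚ
  compose-shift-nonunit e P-irr = compose-lin-nonunit e 1≉0 (irreducible-nonunit P-irr)

  -- Composing with X - s reduces this to P ∤ P(X + s' - s).
  distinct-shifts-∤ : ∀ {P m s s'} → HasDeg P m → 1 ≤ m → m < p → s < p → s' < p → s ≢ s' →
                      ¬ compose P (shift (+ s)) ∣ₚ compose P (shift (+ s'))
  distinct-shifts-∤ {P} {m} {s} {s'} P°m m≥1 m<p s<p s'<p s≢s' Ps∣Ps' =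
    ∤-compose-shift P°m m≥1 m<p e≉0 (∣ₚ-respˡ (≋-trans (compose-shift-lin P cancel) (compose-Xₚ P)) (∣ₚ-respʳ (compose-shift-lin P ≈-refl) (∣ₚ-compose (shift (- + s)) Ps∣Ps')))
    where
    e : ℤ
    e = - + s + + s'
    cancel : - + s + + s ≈ + 0
    cancel = ≈-reflexive (ℤP.+-inverseˡ (+ s))
    e≉0 : ¬ e ≈ + 0
    e≉0 e≈0 = s≢s' (<p-≈⇒≡ s<p s'<p (+-cancelˡ (- + s) (≈-trans (≈-reflexive (ℤP.+-inverseˡ (+ s))) (≈-sym e≈0))))

  module ShiftsOfFactor {F dF} (F°dF : HasDeg F dF) (dF<p : dF < p) {P} (P-irr : Irreducible P) (P∣F : P ∣ₚ F) where

    m<p : deg P-irr < p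
    m<p = ℕP.≤-<-trans (∣ₚ⇒deg≤ P∣F (has-deg P-irr) F°dF) dF<p

    Shift : ℕ → Set
    Shift s = compose P (shift (+ s)) ∣ₚ F

    shifts : Enumeration Shift p
    shifts = enumerate (λ s → ∣ₚ? (HasDeg-compose-shift (+ s) (has-deg P-irr)) F) p

    open Enumeration shifts public

    #shifts≤dF : size ≤ dF
    #shifts≤dF = ℕP.≤-trans size≤size·m (∣ₚ⇒deg≤ product∣F (HasDeg-prodFin size factor (λ i → HasDeg-compose-shift _ (has-deg P-irr))) F°dF)
      where
      factor : Fin size → Poly
      factor i = compose P (shift (+ elem i))
      product∣F : prodFin size factor ∣ₚ F
      product∣F = prodFin-∣ₚ size factor (λ i → compose-shift-prime _ P-irr) (λ i → compose-shift-nonunit _ P-irr)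
        (λ i i' i≢i' → distinct-shifts-∤ (has-deg P-irr) (deg≥1 P-irr) m<p (elem<n i) (elem<n i') (λ eq → i≢i' (injective eq)))
        elem∈D
      size≤size·m : size ≤ size ℕ.* deg P-irr
      size≤size·m = subst (_≤ size ℕ.* deg P-irr) (ℕP.*-identityʳ size) (ℕP.*-monoʳ-≤ size (deg≥1 P-irr))

    zero-shift : Fin size
    zero-shift = proj₁ (complete (ℕP.<-trans (s≤s z≤n) 1<p) (∣ₚ-respˡ (≋-sym (compose-Xₚ P)) P∣F))

    -- For the isolated sum c = s i* + β j*, Q = P(aX + c) divides exactly one factor F(aX + b j), and only once.
    module SimpleFactor (F-sqfree : SquareFree p F) {L} (dF≥1 : 1 ≤ dF) (L≥1 : 1 ≤ L) (bound : (4 ℕ.* dF) ^ L < p)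
             (b : Fin L → ℤ) (b-distinct : ∀ i j → i ≢ j → ¬ b i ≈ b j) (a : ℤ) (a≉0 : ¬ a ≈ + 0) where

      β : Fin L → ℕ
      β j = reduce (b j)

      isolated : ∃₂ λ i* j* → ∀ i j → + (elem i ℕ.+ β j) ≈ + (elem i* ℕ.+ β j*) → j ≡ j*
      isolated = isolated-sum dF≥1 L≥1 bound #shifts≤dF β
        (λ j j' j≢j' βj≈βj' → b-distinct j j' j≢j' (≈-trans (≈-sym (reduce≈ (b j))) (≈-trans βj≈βj' (reduce≈ (b j')))))
        elem zero-shift

      i* : Fin size

      i* = proj₁ isolated
      j* : Fin L
      j* = proj₁ (proj₂ isolated)
      c : ℤ
      c = + (elem i* ℕ.+ β j*)
      Q : Poly
      Q = compose P (lin a c)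

      F∘ : Fin L → Poly
      F∘ j = compose F (lin a (b j))

      Q∣F∘⇒j* : ∀ j → Q ∣ₚ F∘ j → j ≡ j*
      Q∣F∘⇒j* j Q∣F∘j = proj₂ (proj₂ isolated) i j (begin
        + (elem i ℕ.+ β j)     ≡⟨ ℤP.pos-+ (elem i) (β j) ⟩
        + elem i + + β j       ≈⟨ +-cong (≈-reflexive (cong +_ elem-i≡e)) (reduce≈ (b j)) ⟩
        + e + b j              ≈⟨ +-cong (reduce≈ (c - b j)) (≈-refl {b j}) ⟩
        c - b j + b j          ≡⟨ cancel c (b j) ⟩
        c                      ∎)
        where
        open ≈-Reasoning
        e : ℕ
        e = reduce (c - b j)
        cancel : ∀ c b → c - b + b ≡ c
        cancel = solve-∀
        shifted : b j + + e ≈ c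
        shifted = ≈-trans (+-cong (≈-refl {b j}) (reduce≈ (c - b j))) (≈-reflexive (sym-cancel c (b j)))
          where
          sym-cancel : ∀ c b → b + (c - b) ≡ c
          sym-cancel = solve-∀
        Shift-e : Shift e
        Shift-e = ∣ₚ-compose-lin⁻¹ (b j) a≉0 (∣ₚ-respˡ (≋-sym (compose-shift-lin P shifted)) Q∣F∘j)
        i : Fin size
        i = proj₁ (complete (reduce<p (c - b j)) Shift-e)
        elem-i≡e : elem i ≡ e
        elem-i≡e = proj₂ (complete (reduce<p (c - b j)) Shift-e)

      G : Poly

      G = compose P (shift (+ elem i*))

      G∘≋Q : compose G (lin a (b j*)) ≋ Q
      G∘≋Q = compose-shift-lin P (≈-trans (+-cong (≈-sym (reduce≈ (b j*))) (≈-refl {+ elem i*}))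
                          (≈-reflexive (trans (ℤP.+-comm (+ β j*) (+ elem i*)) (sym (ℤP.pos-+ (elem i*) (β j*))))))

      Q∣F∘j* : Q ∣ₚ F∘ j*
      Q∣F∘j* = ∣ₚ-respˡ G∘≋Q (∣ₚ-compose (lin a (b j*)) (elem∈D i*))

      Q²∤F∘j* : ¬ Q *ₚ Q ∣ₚ F∘ j*
      Q²∤F∘j* Q²∣F∘j* = F-sqfree G (deg P-irr) (HasDeg⇒HasDegree (HasDeg-compose-shift _ (has-deg P-irr))) (deg≥1 P-irr)
        (∣ₚ⇒DividesPoly (∣ₚ-compose-lin⁻¹ (b j*) a≉0 {G *ₚ G} {F} (∣ₚ-respˡ (≋-sym G²∘≋Q²) Q²∣F∘j*)))
        where
        G²∘≋Q² : compose (G *ₚ G) (lin a (b j*)) ≋ Q *ₚ Q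
        G²∘≋Q² = ≋-trans (compose-*ₚ G G (lin a (b j*))) (*ₚ-cong G∘≋Q G∘≋Q)

      Q-prime : IsPrimeₚ Q
      Q-prime = compose-lin-prime c a≉0 (irreducible⇒prime P-irr)

      Q≉0 : ¬ IsZero Q
      Q≉0 Q≋0 = HasDeg⇒≉0 (has-deg P-irr) (compose-lin-zero⁻¹ c a≉0 Q≋0)

      simple-factor : ∃ λ R → prodFin L F∘ ≋ Q *ₚ R × ¬ Q ∣ₚ R
      simple-factor = prodFin-simple-factor Q-prime (compose-lin-nonunit c a≉0 (irreducible-nonunit P-irr)) L F∘ j*
        (λ j j≢j* Q∣F∘j → j≢j* (Q∣F∘⇒j* j Q∣F∘j)) (≋-sym (equation Q∣F∘j*))
        (λ Q∣R₀ → Q²∤F∘j* (∣ₚ-respʳ (equation Q∣F∘j*) (∣ₚ-*ₚ-congˡ Q Q∣R₀)))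

-- The statement multiplies naturals; ℤ's _*_ is opened only inside the modules above.
open import Data.Nat using (_*_)

lemma2p3 : (p : ℕ) → Prime p → (F : Poly) → (dF : ℕ) → HasDegree p F dF → 1 ≤ dF → SquareFree p F
    → (L : ℕ) → 1 ≤ L → (b : Fin L → ℤ) → (∀ i j → i ≢ j → ¬ (b i ≡[ p ] b j))
    → (4 * dF) ^ L < p
    → (a : ℤ) → ¬ (a ≡[ p ] + 0)
    → ¬ IsSquareInFracField p (prodFin L (λ j → compose F (lin a (b j))))
lemma2p3 p p-prime F dF F°dF dF≥1 F-sqfree L L≥1 b b-distinct bound a a≢0 (A , B , B≢0 , HB²≈A²) =
  irreducible-factor F°dF' dF≥1 λ P P-irr P∣F →
    let open ShiftsOfFactor F°dF' dF<p P-irr P∣F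
        open SimpleFactor F-sqfree dF≥1 L≥1 bound b (λ i j i≢j bᵢ≈bⱼ → b-distinct i j i≢j (≈⇒≡[p] bᵢ≈bⱼ)) a (λ a≈0 → a≢0 (≈⇒≡[p] a≈0))
        (R , H≋QR , Q∤R) = simple-factor
        (n , B°n) = NonZeroPoly⇒HasDeg {B} B≢0
    in not-square-times-square Q≉0 Q-prime Q∤R {A} {B} B°n (≋-trans (*ₚ-cong (≋-sym H≋QR) (≋-refl {B *ₚ B})) (≈[p]⇒≋ HB²≈A²))
  where
  open Modulo p p-prime
  F°dF' : HasDeg F dF
  F°dF' = HasDegree⇒HasDeg F°dF
  dF<p : dF < p
  dF<p = ℕP.≤-<-trans (ℕP.≤-trans (ℕP.m≤m+n dF _) (≤-^ (4 * dF) L≥1)) bound
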